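{- For all integers $n\ge 0$, all $c\in\{0,1\}$ and all $k\in\mathbb{Z}$, \[ \lim_{N\to\infty}\frac{C_n(c,k,N)}{N}=\frac{1}{2^{n+1}}. \] In particular, the frequency of $0$ (resp., of $1$) in $\mathbf{t}_{3/2}$, namely $\lim_{N\to\infty}\#\{0\le i<N : t_i=0\}/N$ (resp. with $t_i=1$), exists and equals $1/2$.
   Context: Let $\mathbf{t}_{3/2}=(t_n)_{n\ge0}\in\{0,1\}^{\mathbb{N}}$ be the Thue--Morse word in base $3/2$: the unique binary sequence with $t_0=0$ such that $t_{3n}=t_{3n+1}=t_{2n}$ and $t_{3n+2}=1-t_{2n+1}$ for all $n\ge0$. Equivalently, it is the fixed point $\mathbf{t}_{3/2}=\tau(t_0t_1)\tau(t_2t_3)\tau(t_4t_5)\cdots$ of the $2$-block substitution $\tau: 00\mapsto 001,\ 01\mapsto 000,\ 10\mapsto 111,\ 11\mapsto 110$ starting with $0$; it begins $001110111110110111110000110110\cdots$. For integers $n,N\ge0$, $c\in\{0,1\}$ and $k\in\mathbb{Z}$, let $C_n(c,k,N)=\#\{0\le i<N : t_i=c,\ i\equiv k \pmod{2^n}\}$. -}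

module Defs where

open import Data.Bool using (Bool; true; false; not)
open import Data.Bool.Properties using () renaming (_≟_ to _≟ᵇ_)
open import Data.Nat using (ℕ; zero; suc; _+_; _*_; _^_)
open import Data.Nat.Divisibility using (_∣?_)
open import Data.Integer using (ℤ; +_; _-_; ∣_∣)
open import Data.Product using (_×_)
open import Relation.Binary.PropositionalEquality using (_≡_)
open import Relation.Nullary using (yes; no; _×-dec_)

-- Binary letters: false = 0, true = 1.
-- t is the Thue–Morse word in base 3/2: t 0 = 0 and
-- t(3n) = t(3n+1) = t(2n), t(3n+2) = 1 - t(2n+1) for all n.
-- (This determines t uniquely.)
IsThueMorse32 : (ℕ → Bool) → Set
IsThueMorse32 t =
  t 0 ≡ false ×
  (∀ n → t (3 * n) ≡ t (2 * n)
       × t (3 * n + 1) ≡ t (2 * n)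
       × t (3 * n + 2) ≡ not (t (2 * n + 1)))

-- C t n c k N = #{ 0 ≤ i < N : t i = c, i ≡ k (mod 2^n) }
-- (congruence over ℤ: 2^n divides i - k, i.e. 2^n ∣ |i - k| as in stdlib's ℤ-divisibility)
C : (ℕ → Bool) → ℕ → Bool → ℤ → ℕ → ℕ
C t n c k zero = 0
C t n c k (suc N) with (t N ≟ᵇ c) ×-dec ((2 ^ n) ∣? ∣ (+ N) - k ∣)
... | yes _ = suc (C t n c k N)
... | no  _ = C t n c k N

Count : (ℕ → Bool) → Bool → ℕ → ℕ
Count t c zero = 0
Count t c (suc N) with t N ≟ᵇ c
... | yes _ = suc (Count t c N)
... | no  _ = Count t c N

-- Write σ i = (-1)^(t i) and Δ m ℓ N for the sum of σ i over i < N with i ≡ ℓ (mod 2^m). Then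
-- 2·C_n(c,k,N) = #{i < N : i ≡ k (mod 2^n)} ± Δ n k N, so it suffices that Δ n k N = o(N).
-- The recurrences of t turn a sum over i < 3M, split by i mod 3, into sums over i < 2M with the
-- modulus doubled; applied twice, Δ m ℓ (9M) becomes a signed combination of nine sums
-- Δ (m+2) _ (4M), twisted by the odd factor 9, which only permutes residues. For the energy
-- E m N = ∑_ℓ (Δ m ℓ N)² this gives E m (9M) ≤ 20·E (m+2) (4M), and iterating L times against
-- the trivial bound 2^m·E m N ≤ (N + 2^m)·N yields 2^n·(Δ n k (9^L M))² ≤ 80^L·(M + 2^n)·M,
-- which is o((9^L M)²) because 80 < 81.

module Submission where

open import Data.Bool using (Bool)
open import Data.Nat using (ℕ)

module IntegerFacts where

  open import Data.Nat as ℕ using (ℕ; suc)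
  open import Data.Integer using (ℤ; +_; -[1+_]; _+_; _*_; _-_; -_; 0ℤ; _≤_; +≤+; -≤-; ∣_∣; nonNegative)
  open import Data.Integer.Tactic.RingSolver using (solve-∀)
  import Data.Integer.Properties as ℤP
  open import Relation.Binary.PropositionalEquality

  sq : ℤ → ℤ
  sq x = x * x

  sq≡∣∣*∣∣ : ∀ x → sq x ≡ + (∣ x ∣ ℕ.* ∣ x ∣)
  sq≡∣∣*∣∣ (+ n)    = sym (ℤP.pos-* n n)
  sq≡∣∣*∣∣ -[1+ n ] = refl

  sq-nonNeg : ∀ x → 0ℤ ≤ sq x
  sq-nonNeg x = subst (0ℤ ≤_) (sym (sq≡∣∣*∣∣ x)) (+≤+ ℕ.z≤n)

  ≤-by-gap : ∀ {a b} d → b ≡ a + d → 0ℤ ≤ d → a ≤ b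
  ≤-by-gap {a} d b≡a+d 0≤d = subst (a ≤_) (sym b≡a+d) (subst (_≤ a + d) (ℤP.+-identityʳ a) (ℤP.+-monoʳ-≤ a 0≤d))

  ∣x∣≤b-intro : ∀ {x b} → - + b ≤ x → x ≤ + b → ∣ x ∣ ℕ.≤ b
  ∣x∣≤b-intro {+ n}              _         (+≤+ n≤b) = n≤b
  ∣x∣≤b-intro { -[1+ n ]} {suc b} (-≤- n≤b) _         = ℕ.s≤s n≤b

  ∣a-b∣≤d-intro : ∀ {a b} d → a ≤ b + + d → b ≤ a + + d → ∣ a - b ∣ ℕ.≤ d
  ∣a-b∣≤d-intro {a} {b} d a≤b+d b≤a+d = ∣x∣≤b-intro
    (subst₂ _≤_ (cancel₁ a b (+ d)) (cancel₂ a b (+ d)) (ℤP.+-monoˡ-≤ (- b - + d) b≤a+d))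
    (subst (a - b ≤_) (cancel₃ b (+ d)) (ℤP.+-monoˡ-≤ (- b) a≤b+d))
    where cancel₁ : ∀ a b d → b + (- b - d) ≡ - d
          cancel₁ = solve-∀
          cancel₂ : ∀ a b d → a + d + (- b - d) ≡ a - b
          cancel₂ = solve-∀
          cancel₃ : ∀ b d → b + d - b ≡ d
          cancel₃ = solve-∀

  sq≤ : ∀ {x c} → + ∣ x ∣ ≤ c → sq x ≤ c * c
  sq≤ {x} {c} ∣x∣≤c = begin
    sq x                   ≡⟨ sq≡∣∣*∣∣ x ⟩
    + (∣ x ∣ ℕ.* ∣ x ∣)    ≡⟨ ℤP.pos-* ∣ x ∣ ∣ x ∣ ⟩
    + ∣ x ∣ * + ∣ x ∣      ≤⟨ ℤP.*-monoʳ-≤-nonNeg (+ ∣ x ∣) ∣x∣≤c ⟩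
    c * + ∣ x ∣            ≤⟨ ℤP.*-monoˡ-≤-nonNeg c {{nonNegative (ℤP.≤-trans (+≤+ ℕ.z≤n) ∣x∣≤c)}} ∣x∣≤c ⟩
    c * c                  ∎
    where open ℤP.≤-Reasoning

  +[r+k*j] : ∀ r k j → + (r ℕ.+ k ℕ.* j) ≡ + r + + k * + j
  +[r+k*j] r k j = trans (ℤP.pos-+ r (k ℕ.* j)) (cong (λ z → + r + z) (ℤP.pos-* k j))

module IntegerSums where

  open import Data.Nat as ℕ using (ℕ; zero; suc; _^_)
  import Data.Nat.Properties as ℕP
  open import Data.Integer using (ℤ; +_; -[1+_]; _+_; _*_; _-_; -_; 0ℤ; 1ℤ; _≤_; +≤+; ∣_∣; nonNegative)
  import Data.Integer.Properties as ℤP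
  open import Data.Integer.Tactic.RingSolver using (solve-∀)
  open import Algebra.Properties.AbelianGroup ℤP.+-0-abelianGroup using (∙-cancelˡ)
  open import Relation.Binary.PropositionalEquality

  ∑ : ℕ → (ℤ → ℤ) → ℤ
  ∑ zero    f = 0ℤ
  ∑ (suc n) f = ∑ n f + f (+ n)

  ∑-cong : ∀ n {f g : ℤ → ℤ} → (∀ x → f x ≡ g x) → ∑ n f ≡ ∑ n g
  ∑-cong zero    f≡g = refl
  ∑-cong (suc n) f≡g = cong₂ _+_ (∑-cong n f≡g) (f≡g _)

  ∑-cong-< : ∀ n {f g : ℤ → ℤ} → (∀ i → i ℕ.< n → f (+ i) ≡ g (+ i)) → ∑ n f ≡ ∑ n g
  ∑-cong-< zero    f≡g = refl
  ∑-cong-< (suc n) f≡g =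
    cong₂ _+_ (∑-cong-< n (λ i i<n → f≡g i (ℕP.m<n⇒m<1+n i<n))) (f≡g n ℕP.≤-refl)

  ∑-zero : ∀ n → ∑ n (λ _ → 0ℤ) ≡ 0ℤ
  ∑-zero zero    = refl
  ∑-zero (suc n) = cong (_+ 0ℤ) (∑-zero n)

  ∑-one : ∀ n → ∑ n (λ _ → 1ℤ) ≡ + n
  ∑-one zero    = refl
  ∑-one (suc n) = trans (cong (_+ 1ℤ) (∑-one n)) (cong +_ (ℕP.+-comm n 1))

  ∑-+ : ∀ n (f g : ℤ → ℤ) → ∑ n (λ x → f x + g x) ≡ ∑ n f + ∑ n g
  ∑-+ zero    f g = refl
  ∑-+ (suc n) f g = trans (cong (_+ (f (+ n) + g (+ n))) (∑-+ n f g))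
                          (swap-middle (∑ n f) (∑ n g) (f (+ n)) (g (+ n)))
    where swap-middle : ∀ a b c d → a + b + (c + d) ≡ a + c + (b + d)
          swap-middle = solve-∀

  ∑-+₄ : ∀ n (f₀ f₁ f₂ f₃ : ℤ → ℤ) → ∑ n (λ x → f₀ x + f₁ x + f₂ x + f₃ x) ≡ ∑ n f₀ + ∑ n f₁ + ∑ n f₂ + ∑ n f₃
  ∑-+₄ n f₀ f₁ f₂ f₃ = trans (∑-+ n _ f₃) (cong (_+ ∑ n f₃) (trans (∑-+ n _ f₂) (cong (_+ ∑ n f₂) (∑-+ n f₀ f₁))))

  ∑-*ˡ : ∀ n c (f : ℤ → ℤ) → ∑ n (λ x → c * f x) ≡ c * ∑ n f
  ∑-*ˡ zero    c f = sym (ℤP.*-zeroʳ c)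
  ∑-*ˡ (suc n) c f = trans (cong (_+ c * f (+ n)) (∑-*ˡ n c f))
                           (sym (ℤP.*-distribˡ-+ c (∑ n f) (f (+ n))))

  ∑-neg : ∀ n (f : ℤ → ℤ) → ∑ n (λ x → - f x) ≡ - ∑ n f
  ∑-neg zero    f = refl
  ∑-neg (suc n) f = trans (cong (_+ - f (+ n)) (∑-neg n f))
                          (sym (ℤP.neg-distrib-+ (∑ n f) (f (+ n))))

  ∑-mono-≤ : ∀ n {f g : ℤ → ℤ} → (∀ x → f x ≤ g x) → ∑ n f ≤ ∑ n g
  ∑-mono-≤ zero    f≤g = ℤP.≤-refl
  ∑-mono-≤ (suc n) f≤g = ℤP.+-mono-≤ (∑-mono-≤ n f≤g) (f≤g _)

  ∑-nonNeg : ∀ n {f : ℤ → ℤ} → (∀ x → 0ℤ ≤ f x) → 0ℤ ≤ ∑ n f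
  ∑-nonNeg n {f} 0≤f = subst (_≤ ∑ n f) (∑-zero n) (∑-mono-≤ n 0≤f)

  ∣∑∣≤∑ : ∀ n {f g : ℤ → ℤ} → (∀ x → + ∣ f x ∣ ≤ g x) → + ∣ ∑ n f ∣ ≤ ∑ n g
  ∣∑∣≤∑ zero    ∣f∣≤g = ℤP.≤-refl
  ∣∑∣≤∑ (suc n) {f} ∣f∣≤g = begin
    + ∣ ∑ n f + f (+ n) ∣          ≤⟨ +≤+ (ℤP.∣i+j∣≤∣i∣+∣j∣ (∑ n f) (f (+ n))) ⟩
    + (∣ ∑ n f ∣ ℕ.+ ∣ f (+ n) ∣)  ≡⟨ ℤP.pos-+ ∣ ∑ n f ∣ ∣ f (+ n) ∣ ⟩
    + ∣ ∑ n f ∣ + + ∣ f (+ n) ∣    ≤⟨ ℤP.+-mono-≤ (∣∑∣≤∑ n ∣f∣≤g) (∣f∣≤g _) ⟩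
    ∑ (suc n) _                    ∎
    where open ℤP.≤-Reasoning

  ∑-head : ∀ n (f : ℤ → ℤ) → ∑ (suc n) f ≡ f 0ℤ + ∑ n (λ x → f (x + 1ℤ))
  ∑-head zero    f = ℤP.+-comm 0ℤ (f 0ℤ)
  ∑-head (suc n) f = begin
    ∑ (suc n) f + f (+ suc n)                               ≡⟨ cong (_+ f (+ suc n)) (∑-head n f) ⟩
    f 0ℤ + ∑ n (λ x → f (x + 1ℤ)) + f (1ℤ + + n)           ≡⟨ ℤP.+-assoc (f 0ℤ) _ _ ⟩
    f 0ℤ + (∑ n (λ x → f (x + 1ℤ)) + f (1ℤ + + n))         ≡⟨ cong (λ z → f 0ℤ + (∑ n (λ x → f (x + 1ℤ)) + f z)) (ℤP.+-comm 1ℤ (+ n)) ⟩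
    f 0ℤ + (∑ n (λ x → f (x + 1ℤ)) + f (+ n + 1ℤ))         ∎
    where open ≡-Reasoning

  ∑-++ : ∀ a b (f : ℤ → ℤ) → ∑ (a ℕ.+ b) f ≡ ∑ a f + ∑ b (λ x → f (x + + a))
  ∑-++ a zero    f = trans (cong (λ n → ∑ n f) (ℕP.+-identityʳ a)) (sym (ℤP.+-identityʳ _))
  ∑-++ a (suc b) f = begin
    ∑ (a ℕ.+ suc b) f                                         ≡⟨ cong (λ n → ∑ n f) (ℕP.+-suc a b) ⟩
    ∑ (a ℕ.+ b) f + f (+ (a ℕ.+ b))                           ≡⟨ cong₂ _+_ (∑-++ a b f) (cong f (ℤP.pos-+ a b)) ⟩
    ∑ a f + ∑ b (λ x → f (x + + a)) + f (+ a + + b)           ≡⟨ ℤP.+-assoc (∑ a f) _ _ ⟩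
    ∑ a f + (∑ b (λ x → f (x + + a)) + f (+ a + + b))         ≡⟨ cong (λ z → ∑ a f + (∑ b (λ x → f (x + + a)) + f z)) (ℤP.+-comm (+ a) (+ b)) ⟩
    ∑ a f + ∑ (suc b) (λ x → f (x + + a))                     ∎
    where open ≡-Reasoning

  Periodic : ℕ → (ℤ → ℤ) → Set
  Periodic P f = ∀ x → f (x + + P) ≡ f x

  Periodic-translate : ∀ P {f : ℤ → ℤ} c → Periodic P f → Periodic P (λ x → f (x + c))
  Periodic-translate P {f} c f-per x = trans (cong f (swap x (+ P) c)) (f-per (x + c))
    where swap : ∀ a b c → a + b + c ≡ a + c + b
          swap = solve-∀

  ∑-translate-1 : ∀ P {f : ℤ → ℤ} → Periodic P f → ∑ P (λ x → f (x + 1ℤ)) ≡ ∑ P f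
  ∑-translate-1 P {f} f-per = ∙-cancelˡ (f 0ℤ) _ _ (begin
    f 0ℤ + ∑ P (λ x → f (x + 1ℤ))   ≡⟨ ∑-head P f ⟨
    ∑ P f + f (+ P)                 ≡⟨ cong (λ z → ∑ P f + z) (f-per 0ℤ) ⟩
    ∑ P f + f 0ℤ                    ≡⟨ ℤP.+-comm (∑ P f) (f 0ℤ) ⟩
    f 0ℤ + ∑ P f                    ∎)
    where open ≡-Reasoning

  ∑-translate-ℕ : ∀ P {f : ℤ → ℤ} → Periodic P f → ∀ c → ∑ P (λ x → f (x + + c)) ≡ ∑ P f
  ∑-translate-ℕ P {f} f-per zero    = ∑-cong P (λ x → cong f (ℤP.+-identityʳ x))
  ∑-translate-ℕ P {f} f-per (suc c) = begin
    ∑ P (λ x → f (x + + suc c))         ≡⟨ ∑-cong P (λ x → cong f (reassoc x (+ c))) ⟩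
    ∑ P (λ x → f (x + 1ℤ + + c))        ≡⟨ ∑-translate-1 P (Periodic-translate P (+ c) f-per) ⟩
    ∑ P (λ x → f (x + + c))             ≡⟨ ∑-translate-ℕ P f-per c ⟩
    ∑ P f                               ∎
    where open ≡-Reasoning
          reassoc : ∀ x c → x + (1ℤ + c) ≡ x + 1ℤ + c
          reassoc = solve-∀

  ∑-translate : ∀ P {f : ℤ → ℤ} → Periodic P f → ∀ c → ∑ P (λ x → f (x + c)) ≡ ∑ P f
  ∑-translate P f-per (+ c)    = ∑-translate-ℕ P f-per c
  ∑-translate P {f} f-per -[1+ c ] = begin
    ∑ P (λ x → f (x + -[1+ c ]))                      ≡⟨ ∑-translate-ℕ P (Periodic-translate P -[1+ c ] f-per) (suc c) ⟨
    ∑ P (λ x → f (x + + suc c + -[1+ c ]))            ≡⟨ ∑-cong P (λ x → cong f (cancel x (+ suc c))) ⟩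
    ∑ P f                                             ∎
    where open ≡-Reasoning
          cancel : ∀ x c → x + c + - c ≡ x
          cancel = solve-∀

  ∑-telescope : ∀ P {g : ℤ → ℤ} → Periodic P g → ∀ c → ∑ P (λ x → g (x + c) - g x) ≡ 0ℤ
  ∑-telescope P {g} g-per c = begin
    ∑ P (λ x → g (x + c) - g x)              ≡⟨ ∑-+ P (λ x → g (x + c)) (λ x → - g x) ⟩
    ∑ P (λ x → g (x + c)) + ∑ P (λ x → - g x) ≡⟨ cong₂ _+_ (∑-translate P g-per c) (∑-neg P g) ⟩
    ∑ P g - ∑ P g                            ≡⟨ ℤP.+-inverseʳ (∑ P g) ⟩
    0ℤ                                       ∎
    where open ≡-Reasoning

  ∑-blocks : ∀ m P (f : ℤ → ℤ) → ∑ (P ℕ.* m) f ≡ ∑ P (λ b → ∑ m (λ j → f (+ m * b + j)))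
  ∑-blocks m zero    f = refl
  ∑-blocks m (suc P) f = begin
    ∑ (m ℕ.+ P ℕ.* m) f                                       ≡⟨ cong (λ n → ∑ n f) (ℕP.+-comm m (P ℕ.* m)) ⟩
    ∑ (P ℕ.* m ℕ.+ m) f                                       ≡⟨ ∑-++ (P ℕ.* m) m f ⟩
    ∑ (P ℕ.* m) f + ∑ m (λ j → f (j + + (P ℕ.* m)))           ≡⟨ cong₂ _+_ (∑-blocks m P f) (∑-cong m (λ j → cong f (block-start j))) ⟩
    ∑ P (λ b → ∑ m (λ j → f (+ m * b + j))) + ∑ m (λ j → f (+ m * + P + j)) ∎
    where
    open ≡-Reasoning
    block-start : ∀ j → j + + (P ℕ.* m) ≡ + m * + P + j
    block-start j = trans (ℤP.+-comm j _) (cong (_+ j) (trans (ℤP.pos-* P m) (ℤP.*-comm (+ P) (+ m))))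

  ∑-even-odd : ∀ P (f : ℤ → ℤ) → ∑ (P ℕ.* 2) f ≡ ∑ P (λ a → f (+ 2 * a)) + ∑ P (λ a → f (+ 2 * a + 1ℤ))
  ∑-even-odd P f = begin
    ∑ (P ℕ.* 2) f                                                 ≡⟨ ∑-blocks 2 P f ⟩
    ∑ P (λ a → 0ℤ + f (+ 2 * a + 0ℤ) + f (+ 2 * a + 1ℤ))          ≡⟨ ∑-cong P (λ a → cong (λ z → 0ℤ + f z + f (+ 2 * a + 1ℤ)) (ℤP.+-identityʳ _)) ⟩
    ∑ P (λ a → 0ℤ + f (+ 2 * a) + f (+ 2 * a + 1ℤ))               ≡⟨ ∑-+ P (λ a → 0ℤ + f (+ 2 * a)) (λ a → f (+ 2 * a + 1ℤ)) ⟩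
    ∑ P (λ a → 0ℤ + f (+ 2 * a)) + ∑ P (λ a → f (+ 2 * a + 1ℤ))   ≡⟨ cong (_+ ∑ P (λ a → f (+ 2 * a + 1ℤ))) (∑-cong P (λ a → ℤP.+-identityˡ _)) ⟩
    ∑ P (λ a → f (+ 2 * a)) + ∑ P (λ a → f (+ 2 * a + 1ℤ))        ∎
    where open ≡-Reasoning

  ∑-odd-dilation : ∀ m v {f : ℤ → ℤ} → Periodic (2 ^ m) f →
                   ∑ (2 ^ m) (λ x → f ((1ℤ + + 2 * v) * x)) ≡ ∑ (2 ^ m) f
  ∑-odd-dilation zero    v {f} f-per = cong (λ z → 0ℤ + f z) (ℤP.*-zeroʳ (1ℤ + + 2 * v))
  ∑-odd-dilation (suc m) v {f} f-per = begin
    ∑ (2 ^ suc m) (λ x → f (u * x))                                   ≡⟨ cong (λ n → ∑ n (λ x → f (u * x))) (ℕP.*-comm 2 P) ⟩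
    ∑ (P ℕ.* 2) (λ x → f (u * x))                                     ≡⟨ ∑-even-odd P (λ x → f (u * x)) ⟩
    ∑ P (λ a → f (u * (+ 2 * a))) + ∑ P (λ a → f (u * (+ 2 * a + 1ℤ))) ≡⟨ cong₂ _+_ (∑-cong P (λ a → cong f (u*2a u a))) (∑-cong P (λ a → cong f (u*[2a+1] v a))) ⟩
    ∑ P (λ a → evens (u * a)) + ∑ P (λ a → odds (u * a + v))          ≡⟨ cong₂ _+_ (∑-odd-dilation m v evens-per) (∑-odd-dilation m v (Periodic-translate P v odds-per)) ⟩
    ∑ P evens + ∑ P (λ b → odds (b + v))                              ≡⟨ cong (λ z → ∑ P evens + z) (∑-translate P odds-per v) ⟩
    ∑ P evens + ∑ P odds                                              ≡⟨ ∑-even-odd P f ⟨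
    ∑ (P ℕ.* 2) f                                                     ≡⟨ cong (λ n → ∑ n f) (ℕP.*-comm P 2) ⟩
    ∑ (2 ^ suc m) f                                                   ∎
    where
    open ≡-Reasoning
    P = 2 ^ m
    u = 1ℤ + + 2 * v
    evens odds : ℤ → ℤ
    evens b = f (+ 2 * b)
    odds  b = f (+ 2 * b + 1ℤ)
    u*2a : ∀ u a → u * (+ 2 * a) ≡ + 2 * (u * a)
    u*2a = solve-∀
    u*[2a+1] : ∀ v a → (1ℤ + + 2 * v) * (+ 2 * a + 1ℤ) ≡ + 2 * ((1ℤ + + 2 * v) * a + v) + 1ℤ
    u*[2a+1] = solve-∀
    double-period : ∀ b → + 2 * (b + + P) ≡ + 2 * b + + (2 ^ suc m)
    double-period b = trans (ℤP.*-distribˡ-+ (+ 2) b (+ P)) (cong (λ z → + 2 * b + z) (sym (ℤP.pos-* 2 P)))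
    evens-per : Periodic P evens
    evens-per b = trans (cong f (double-period b)) (f-per (+ 2 * b))
    odds-per : Periodic P odds
    odds-per b = trans (cong (λ z → f (z + 1ℤ)) (double-period b))
                       (trans (cong f (swap (+ 2 * b) (+ (2 ^ suc m)) 1ℤ)) (f-per (+ 2 * b + 1ℤ)))
      where swap : ∀ a b c → a + b + c ≡ a + c + b
            swap = solve-∀

  term≤∑-periodic : ∀ P .{{_ : ℕ.NonZero P}} {f : ℤ → ℤ} → Periodic P f → (∀ x → 0ℤ ≤ f x) → ∀ k → f k ≤ ∑ P f
  term≤∑-periodic (suc P) {f} f-per 0≤f k = begin
    f k                                   ≡⟨ cong f (ℤP.+-identityˡ k) ⟨
    f (0ℤ + k)                            ≤⟨ ℤP.i≤i+j (f (0ℤ + k)) _ {{nonNegative (∑-nonNeg P (λ x → 0≤f (x + 1ℤ + k)))}} ⟩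
    f (0ℤ + k) + ∑ P (λ x → f (x + 1ℤ + k)) ≡⟨ ∑-head P (λ x → f (x + k)) ⟨
    ∑ (suc P) (λ x → f (x + k))           ≡⟨ ∑-translate (suc P) f-per k ⟩
    ∑ (suc P) f                           ∎
    where open ℤP.≤-Reasoning

module PowerOfTwoIndicator where

  open import Data.Nat as ℕ using (ℕ; zero; suc; _^_)
  import Data.Nat.Properties as ℕP
  import Data.Nat.Divisibility as ℕD
  open import Data.Integer using (ℤ; +_; _+_; _*_; _-_; -_; 0ℤ; 1ℤ; _≤_; +≤+; ∣_∣)
  import Data.Integer.Properties as ℤP
  open import Data.Integer.Divisibility.Signed using (_∣_; divides; ∣ᵤ⇒∣; ∣⇒∣ᵤ; ∣-trans; ∣-refl;
    ∣m∣n⇒∣m+n; ∣m∣n⇒∣m-n; ∣m⇒∣-m; ∣m+n∣m⇒∣n; ∣n⇒∣m*n; ∣m⇒∣m*n; *-monoʳ-∣; *-cancelˡ-∣)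
  open import Data.Integer.Tactic.RingSolver using (solve-∀)
  open import Data.Product using (_×_; _,_)
  open import Data.Empty using (⊥-elim)
  open import Relation.Nullary using (yes; no; ¬_)
  open import Relation.Binary.PropositionalEquality
  open IntegerSums

  -- Decided on ∣ x ∣ by unsigned divisibility, exactly as in the definition of C, so that
  -- C-relation can case on the very same test.
  [2^_∣_] : ℕ → ℤ → ℤ
  [2^ m ∣ x ] with 2 ^ m ℕD.∣? ∣ x ∣
  ... | yes _ = 1ℤ
  ... | no  _ = 0ℤ

  2^_∣_ : ℕ → ℤ → Set
  2^ m ∣ x = + (2 ^ m) ∣ x

  [2^∣]-yes : ∀ m {x} → 2^ m ∣ x → [2^ m ∣ x ] ≡ 1ℤ
  [2^∣]-yes m {x} d with 2 ^ m ℕD.∣? ∣ x ∣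
  ... | yes _ = refl
  ... | no ¬d = ⊥-elim (¬d (∣⇒∣ᵤ d))

  [2^∣]-no : ∀ m {x} → ¬ 2^ m ∣ x → [2^ m ∣ x ] ≡ 0ℤ
  [2^∣]-no m {x} ¬d with 2 ^ m ℕD.∣? ∣ x ∣
  ... | yes d = ⊥-elim (¬d (∣ᵤ⇒∣ d))
  ... | no _  = refl

  [2^∣]-cong : ∀ m n {x y} → (2^ m ∣ x → 2^ n ∣ y) → (2^ n ∣ y → 2^ m ∣ x) → [2^ m ∣ x ] ≡ [2^ n ∣ y ]
  [2^∣]-cong m n {x} {y} x⇒y y⇒x with 2 ^ m ℕD.∣? ∣ x ∣
  ... | yes dx = sym ([2^∣]-yes n (x⇒y (∣ᵤ⇒∣ dx)))
  ... | no ¬dx = sym ([2^∣]-no n (λ dy → ¬dx (∣⇒∣ᵤ (y⇒x dy))))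

  [2^∣]-≡-mod : ∀ m {x y} → 2^ m ∣ (x - y) → [2^ m ∣ x ] ≡ [2^ m ∣ y ]
  [2^∣]-≡-mod m {x} {y} d = [2^∣]-cong m m
    (λ dx → subst (2^ m ∣_) (x-[x-y] x y) (∣m∣n⇒∣m-n dx d))
    (λ dy → subst (2^ m ∣_) (x-y+y x y) (∣m∣n⇒∣m+n d dy))
    where x-[x-y] : ∀ x y → x - (x - y) ≡ y
          x-[x-y] = solve-∀
          x-y+y : ∀ x y → x - y + y ≡ x
          x-y+y = solve-∀

  [2^∣]-periodic : ∀ m → Periodic (2 ^ m) [2^ m ∣_]
  [2^∣]-periodic m x = [2^∣]-≡-mod m (divides 1ℤ (x+P-x x (+ (2 ^ m))))
    where x+P-x : ∀ x P → x + P - x ≡ 1ℤ * P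
          x+P-x = solve-∀

  [2^∣]-neg : ∀ m x → [2^ m ∣ - x ] ≡ [2^ m ∣ x ]
  [2^∣]-neg m x = [2^∣]-cong m m (λ d → subst (2^ m ∣_) (ℤP.neg-involutive x) (∣m⇒∣-m d)) ∣m⇒∣-m

  [2^∣]-bounded : ∀ m x → 0ℤ ≤ [2^ m ∣ x ] × [2^ m ∣ x ] ≤ 1ℤ
  [2^∣]-bounded m x with 2 ^ m ℕD.∣? ∣ x ∣
  ... | yes _ = +≤+ ℕ.z≤n , ℤP.≤-refl
  ... | no  _ = +≤+ ℕ.z≤n , +≤+ ℕ.z≤n

  [2^∣]-zero : ∀ m → [2^ m ∣ 0ℤ ] ≡ 1ℤ
  [2^∣]-zero m = [2^∣]-yes m (∣ᵤ⇒∣ (ℕD._∣0 (2 ^ m)))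

  [2^∣]-small : ∀ m {i} → 0 ℕ.< i → i ℕ.< 2 ^ m → [2^ m ∣ + i ] ≡ 0ℤ
  [2^∣]-small m {suc i} _ i<2^m = [2^∣]-no m (λ d → ℕP.<⇒≱ i<2^m (ℕD.∣⇒≤ (∣⇒∣ᵤ d)))

  2^-suc : ∀ m → + (2 ^ suc m) ≡ + 2 * + (2 ^ m)
  2^-suc m = ℤP.pos-* 2 (2 ^ m)

  halve-∣ : ∀ m {x} → 2^ suc m ∣ (+ 2 * x) → 2^ m ∣ x
  halve-∣ m d = *-cancelˡ-∣ (+ 2) (subst (_∣ _) (2^-suc m) d)

  double-∣ : ∀ m {x} → 2^ m ∣ x → 2^ suc m ∣ (+ 2 * x)
  double-∣ m d = subst (_∣ _) (sym (2^-suc m)) (*-monoʳ-∣ (+ 2) d)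

  [2^∣]-double : ∀ m x → [2^ suc m ∣ + 2 * x ] ≡ [2^ m ∣ x ]
  [2^∣]-double m x = [2^∣]-cong (suc m) m (halve-∣ m) (double-∣ m)

  [2^∣]-double′ : ∀ m {x x′} → x′ ≡ + 2 * x → [2^ suc m ∣ x′ ] ≡ [2^ m ∣ x ]
  [2^∣]-double′ m {x} x′≡2x = trans (cong [2^ suc m ∣_] x′≡2x) ([2^∣]-double m x)

  2∣2^suc : ∀ m → + 2 ∣ + (2 ^ suc m)
  2∣2^suc m = ∣ᵤ⇒∣ (ℕD.m∣m*n (2 ^ m))

  2∤odd : ∀ x → ¬ + 2 ∣ (+ 2 * x + 1ℤ)
  2∤odd x 2∣odd with ℕD.∣1⇒≡1 (∣⇒∣ᵤ (∣m+n∣m⇒∣n 2∣odd (∣m⇒∣m*n x ∣-refl)))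
  ... | ()

  [2^∣]-odd : ∀ m x → [2^ suc m ∣ + 2 * x + 1ℤ ] ≡ 0ℤ
  [2^∣]-odd m x = [2^∣]-no (suc m) (λ d → 2∤odd x (∣-trans (2∣2^suc m) d))

  2∣-odd-* : ∀ v {x} → + 2 ∣ ((1ℤ + + 2 * v) * x) → + 2 ∣ x
  2∣-odd-* v {x} d = ∣m+n∣m⇒∣n (subst (+ 2 ∣_) (expand v x) d) (∣m⇒∣m*n (v * x) ∣-refl)
    where expand : ∀ v x → (1ℤ + + 2 * v) * x ≡ + 2 * (v * x) + x
          expand = solve-∀

  odd-*-∣ : ∀ m v {x} → 2^ m ∣ ((1ℤ + + 2 * v) * x) → 2^ m ∣ x
  odd-*-∣ zero    v {x} d = ∣ᵤ⇒∣ (ℕD.1∣ ∣ x ∣)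
  odd-*-∣ (suc m) v {x} d with 2∣-odd-* v (∣-trans (2∣2^suc m) d)
  ... | divides y refl = subst (2^ suc m ∣_) (ℤP.*-comm (+ 2) y)
        (double-∣ m (odd-*-∣ m v (halve-∣ m (subst (2^ suc m ∣_) (regroup v y) d))))
    where regroup : ∀ v y → (1ℤ + + 2 * v) * (y * + 2) ≡ + 2 * ((1ℤ + + 2 * v) * y)
          regroup = solve-∀

  [2^∣]-odd-* : ∀ m v x → [2^ m ∣ (1ℤ + + 2 * v) * x ] ≡ [2^ m ∣ x ]
  [2^∣]-odd-* m v x = [2^∣]-cong m m (odd-*-∣ m v) (∣n⇒∣m*n (1ℤ + + 2 * v))

module ResidueCounts where

  open import Data.Nat as ℕ using (ℕ; zero; suc; _^_; NonZero)
  import Data.Nat.Properties as ℕP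
  open import Data.Nat.DivMod using (_/_; _%_; m≡m%n+[m/n]*n; m%n<n; m/n*n≤m)
  open import Data.Integer using (ℤ; +_; _+_; _*_; _-_; -_; 0ℤ; 1ℤ; _≤_; +≤+; ∣_∣)
  import Data.Integer.Properties as ℤP
  open import Data.Integer.Tactic.RingSolver using (solve-∀)
  open import Data.Product using (_×_; _,_; proj₁; proj₂)
  open import Relation.Binary.PropositionalEquality
  open IntegerFacts
  open IntegerSums
  open PowerOfTwoIndicator

  2^-suc-pred : ∀ m → suc (ℕ.pred (2 ^ m)) ≡ 2 ^ m
  2^-suc-pred m = ℕP.suc-pred (2 ^ m) {{ℕP.m^n≢0 2 m}}

  ∑-[2^∣]-period : ∀ m → ∑ (2 ^ m) [2^ m ∣_] ≡ 1ℤ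
  ∑-[2^∣]-period m = begin
    ∑ (2 ^ m) [2^ m ∣_]                                  ≡⟨ cong (λ n → ∑ n [2^ m ∣_]) (2^-suc-pred m) ⟨
    ∑ (suc P′) [2^ m ∣_]                                 ≡⟨ ∑-head P′ [2^ m ∣_] ⟩
    [2^ m ∣ 0ℤ ] + ∑ P′ (λ x → [2^ m ∣ x + 1ℤ ])         ≡⟨ cong₂ _+_ ([2^∣]-zero m) (∑-cong-< P′ nonzero-residue) ⟩
    1ℤ + ∑ P′ (λ _ → 0ℤ)                                 ≡⟨ cong (λ z → 1ℤ + z) (∑-zero P′) ⟩
    1ℤ                                                   ∎
    where
    open ≡-Reasoning
    P′ = ℕ.pred (2 ^ m)
    nonzero-residue : ∀ i → i ℕ.< P′ → [2^ m ∣ + i + 1ℤ ] ≡ 0ℤ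
    nonzero-residue i i<P′ = trans (cong (λ n → [2^ m ∣ + n ]) (ℕP.+-comm i 1))
      ([2^∣]-small m (ℕ.s≤s ℕ.z≤n) (subst (suc (suc i) ℕ.≤_) (2^-suc-pred m) (ℕ.s≤s i<P′)))

  ∑-[2^∣] : ∀ m c → ∑ (2 ^ m) (λ x → [2^ m ∣ x + c ]) ≡ 1ℤ
  ∑-[2^∣] m c = trans (∑-translate (2 ^ m) ([2^∣]-periodic m) c) (∑-[2^∣]-period m)

  count≡ : ℕ → ℤ → ℕ → ℤ
  count≡ m ℓ N = ∑ N (λ i → [2^ m ∣ i - ℓ ])

  count≡-nonNeg : ∀ m ℓ N → 0ℤ ≤ count≡ m ℓ N
  count≡-nonNeg m ℓ N = ∑-nonNeg N (λ i → proj₁ ([2^∣]-bounded m (i - ℓ)))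

  count≡-+-period : ∀ m ℓ N → count≡ m ℓ (N ℕ.+ 2 ^ m) ≡ count≡ m ℓ N + 1ℤ
  count≡-+-period m ℓ N = trans (∑-++ N (2 ^ m) _)
    (cong (λ z → count≡ m ℓ N + z) (trans (∑-cong (2 ^ m) (λ x → cong [2^ m ∣_] (ℤP.+-assoc x (+ N) (- ℓ))))
                                   (∑-[2^∣] m (+ N - ℓ))))

  count≡-+-mono : ∀ m ℓ N a → count≡ m ℓ N ≤ count≡ m ℓ (N ℕ.+ a)
  count≡-+-mono m ℓ N a = ≤-by-gap _ (∑-++ N a _) (∑-nonNeg a (λ x → proj₁ ([2^∣]-bounded m (x + + N - ℓ))))

  count≡-multiple : ∀ m ℓ q → count≡ m ℓ (q ℕ.* 2 ^ m) ≡ + q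
  count≡-multiple m ℓ zero    = refl
  count≡-multiple m ℓ (suc q) = begin
    count≡ m ℓ (2 ^ m ℕ.+ q ℕ.* 2 ^ m)   ≡⟨ cong (count≡ m ℓ) (ℕP.+-comm (2 ^ m) (q ℕ.* 2 ^ m)) ⟩
    count≡ m ℓ (q ℕ.* 2 ^ m ℕ.+ 2 ^ m)   ≡⟨ count≡-+-period m ℓ (q ℕ.* 2 ^ m) ⟩
    count≡ m ℓ (q ℕ.* 2 ^ m) + 1ℤ        ≡⟨ cong (_+ 1ℤ) (count≡-multiple m ℓ q) ⟩
    + q + 1ℤ                             ≡⟨ cong +_ (ℕP.+-comm q 1) ⟩
    + suc q                              ∎
    where open ≡-Reasoning

  ∑-count≡ : ∀ m N → ∑ (2 ^ m) (λ ℓ → count≡ m ℓ N) ≡ + N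
  ∑-count≡ m zero    = ∑-zero (2 ^ m)
  ∑-count≡ m (suc N) = begin
    ∑ (2 ^ m) (λ ℓ → count≡ m ℓ N + [2^ m ∣ + N - ℓ ])              ≡⟨ ∑-+ (2 ^ m) _ _ ⟩
    ∑ (2 ^ m) (λ ℓ → count≡ m ℓ N) + ∑ (2 ^ m) (λ ℓ → [2^ m ∣ + N - ℓ ]) ≡⟨ cong₂ _+_ (∑-count≡ m N) (∑-cong (2 ^ m) flip) ⟩
    + N + ∑ (2 ^ m) (λ ℓ → [2^ m ∣ ℓ + - + N ])                     ≡⟨ cong (λ z → + N + z) (∑-[2^∣] m (- + N)) ⟩
    + N + 1ℤ                                                        ≡⟨ cong +_ (ℕP.+-comm N 1) ⟩
    + suc N                                                         ∎
    where
    open ≡-Reasoning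
    flip : ∀ ℓ → [2^ m ∣ + N - ℓ ] ≡ [2^ m ∣ ℓ + - + N ]
    flip ℓ = trans (sym ([2^∣]-neg m (+ N - ℓ))) (cong [2^ m ∣_] (negate (+ N) ℓ))
      where negate : ∀ n ℓ → - (n - ℓ) ≡ ℓ + - n
            negate = solve-∀

  module _ (m : ℕ) where

    private
      P = 2 ^ m
      instance
        P≢0 : NonZero P
        P≢0 = ℕP.m^n≢0 2 m

      N≡[N/P]P+N%P : ∀ N → N ≡ N / P ℕ.* P ℕ.+ N % P
      N≡[N/P]P+N%P N = trans (m≡m%n+[m/n]*n N P) (ℕP.+-comm (N % P) _)

    count≡-between : ∀ ℓ N → + (N / P) ≤ count≡ m ℓ N × count≡ m ℓ N ≤ + (N / P) + 1ℤ
    count≡-between ℓ N = lower , upper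
      where
      q = N / P
      r = N % P
      N≡qP+r : N ≡ q ℕ.* P ℕ.+ r
      N≡qP+r = N≡[N/P]P+N%P N
      lower : + q ≤ count≡ m ℓ N
      lower = subst₂ _≤_ (count≡-multiple m ℓ q) (cong (count≡ m ℓ) (sym N≡qP+r)) (count≡-+-mono m ℓ (q ℕ.* P) r)
      N+[P∸r]≡[1+q]P : N ℕ.+ (P ℕ.∸ r) ≡ suc q ℕ.* P
      N+[P∸r]≡[1+q]P = begin
        N ℕ.+ (P ℕ.∸ r)                 ≡⟨ cong (ℕ._+ (P ℕ.∸ r)) N≡qP+r ⟩
        q ℕ.* P ℕ.+ r ℕ.+ (P ℕ.∸ r)     ≡⟨ ℕP.+-assoc (q ℕ.* P) r (P ℕ.∸ r) ⟩
        q ℕ.* P ℕ.+ (r ℕ.+ (P ℕ.∸ r))   ≡⟨ cong (q ℕ.* P ℕ.+_) (ℕP.m+[n∸m]≡n (ℕP.<⇒≤ (m%n<n N P))) ⟩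
        q ℕ.* P ℕ.+ P                   ≡⟨ ℕP.+-comm (q ℕ.* P) P ⟩
        suc q ℕ.* P                     ∎
        where open ≡-Reasoning
      upper : count≡ m ℓ N ≤ + q + 1ℤ
      upper = subst (count≡ m ℓ N ≤_) (trans (count≡-multiple m ℓ (suc q)) (cong +_ (ℕP.+-comm 1 q)))
                (subst (λ n → count≡ m ℓ N ≤ count≡ m ℓ n) N+[P∸r]≡[1+q]P (count≡-+-mono m ℓ N (P ℕ.∸ r)))

    count≡-close : ∀ ℓ N → + P * count≡ m ℓ N ≤ + N + + P × ∣ + P * count≡ m ℓ N - + N ∣ ℕ.≤ P
    count≡-close ℓ N = Pc≤N+P , ∣a-b∣≤d-intro P Pc≤N+P N≤Pc+P
      where
      open ℤP.≤-Reasoning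
      q = N / P
      c = count≡ m ℓ N
      +qP : + (q ℕ.* P) ≡ + P * + q
      +qP = trans (ℤP.pos-* q P) (ℤP.*-comm (+ q) (+ P))
      Pc≤N+P : + P * c ≤ + N + + P
      Pc≤N+P = begin
        + P * c                 ≤⟨ ℤP.*-monoˡ-≤-nonNeg (+ P) (proj₂ (count≡-between ℓ N)) ⟩
        + P * (+ q + 1ℤ)        ≡⟨ ℤP.*-distribˡ-+ (+ P) (+ q) 1ℤ ⟩
        + P * + q + + P * 1ℤ    ≡⟨ cong₂ _+_ (sym +qP) (ℤP.*-identityʳ (+ P)) ⟩
        + (q ℕ.* P) + + P       ≤⟨ ℤP.+-monoˡ-≤ (+ P) (+≤+ (m/n*n≤m N P)) ⟩
        + N + + P               ∎
      N≤Pc+P : + N ≤ + P * c + + P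
      N≤Pc+P = begin
        + N                     ≡⟨ cong +_ (N≡[N/P]P+N%P N) ⟩
        + (q ℕ.* P ℕ.+ N % P)   ≤⟨ +≤+ (ℕP.+-monoʳ-≤ (q ℕ.* P) (ℕP.<⇒≤ (m%n<n N P))) ⟩
        + (q ℕ.* P ℕ.+ P)       ≡⟨ ℤP.pos-+ (q ℕ.* P) P ⟩
        + (q ℕ.* P) + + P       ≡⟨ cong (_+ + P) +qP ⟩
        + P * + q + + P         ≤⟨ ℤP.+-monoˡ-≤ (+ P) (ℤP.*-monoˡ-≤-nonNeg (+ P) (proj₁ (count≡-between ℓ N))) ⟩
        + P * c + + P           ∎

module TwoStepEnergy where

  open import Data.Nat as ℕ using (ℕ)
  import Data.Nat.Properties as ℕP
  open import Data.Integer using (ℤ; +_; _+_; _*_; _-_; -_; 0ℤ; 1ℤ; _≤_)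
  import Data.Integer.Properties as ℤP
  open import Data.Integer.Tactic.RingSolver using (solve-∀)
  open import Relation.Binary.PropositionalEquality
  open IntegerSums
  open IntegerFacts

  sq-+₄ : ∀ a b c d → sq (a + b + c + d) ≤ + 4 * (sq a + sq b + sq c + sq d)
  sq-+₄ a b c d = ≤-by-gap (sq (a - b) + sq (a - c) + sq (a - d) + sq (b - c) + sq (b - d) + sq (c - d))
    (lagrange a b c d)
    (nonNeg₆ (sq-nonNeg (a - b)) (sq-nonNeg (a - c)) (sq-nonNeg (a - d)) (sq-nonNeg (b - c)) (sq-nonNeg (b - d)) (sq-nonNeg (c - d)))
    where
    lagrange : ∀ a b c d → + 4 * ((a * a) + (b * b) + (c * c) + (d * d))
             ≡ (a + b + c + d) * (a + b + c + d)
               + ((a - b) * (a - b) + (a - c) * (a - c) + (a - d) * (a - d) + (b - c) * (b - c) + (b - d) * (b - d) + (c - d) * (c - d))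
    lagrange = solve-∀
    nonNeg₆ : ∀ {x₁ x₂ x₃ x₄ x₅ x₆} → 0ℤ ≤ x₁ → 0ℤ ≤ x₂ → 0ℤ ≤ x₃ → 0ℤ ≤ x₄ → 0ℤ ≤ x₅ → 0ℤ ≤ x₆ →
              0ℤ ≤ x₁ + x₂ + x₃ + x₄ + x₅ + x₆
    nonNeg₆ p₁ p₂ p₃ p₄ p₅ p₆ = ℤP.+-mono-≤ (ℤP.+-mono-≤ (ℤP.+-mono-≤ (ℤP.+-mono-≤ (ℤP.+-mono-≤ p₁ p₂) p₃) p₄) p₅) p₆

  ∑-telescope₂ : ∀ P {g : ℤ → ℤ} → Periodic P g → ∑ P (λ k → g (k - 1ℤ - 1ℤ) - g k) ≡ 0ℤ
  ∑-telescope₂ P {g} g-per = begin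
    ∑ P (λ k → g (k - 1ℤ - 1ℤ) - g k)                                          ≡⟨ ∑-cong P (λ k → split (g (k - 1ℤ - 1ℤ)) (g (k - 1ℤ)) (g k)) ⟩
    ∑ P (λ k → (g (k - 1ℤ - 1ℤ) - g (k - 1ℤ)) + (g (k - 1ℤ) - g k))            ≡⟨ ∑-+ P _ _ ⟩
    ∑ P (λ k → g (k - 1ℤ - 1ℤ) - g (k - 1ℤ)) + ∑ P (λ k → g (k - 1ℤ) - g k)    ≡⟨ cong₂ _+_ (∑-telescope P (Periodic-translate P (- 1ℤ) g-per) (- 1ℤ))
                                                                                             (∑-telescope P g-per (- 1ℤ)) ⟩
    0ℤ                                                                         ∎
    where open ≡-Reasoning
          split : ∀ a b c → a - c ≡ (a - b) + (b - c)
          split = solve-∀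

  ∑-modulo-telescopes : ∀ P {F G H J : ℤ → ℤ} c → Periodic P H → Periodic P J →
    (∀ k → F k ≡ c * G k + (H (k - 1ℤ) - H k) + (J (k - 1ℤ - 1ℤ) - J k)) → ∑ P F ≡ c * ∑ P G
  ∑-modulo-telescopes P {F} {G} {H} {J} c H-per J-per F≡ = begin
    ∑ P F                                                                      ≡⟨ ∑-cong P F≡ ⟩
    ∑ P (λ k → c * G k + (H (k - 1ℤ) - H k) + (J (k - 1ℤ - 1ℤ) - J k))         ≡⟨ ∑-+ P _ _ ⟩
    ∑ P (λ k → c * G k + (H (k - 1ℤ) - H k)) + ∑ P (λ k → J (k - 1ℤ - 1ℤ) - J k) ≡⟨ cong₂ _+_ (∑-+ P _ _) (∑-telescope₂ P J-per) ⟩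
    ∑ P (λ k → c * G k) + ∑ P (λ k → H (k - 1ℤ) - H k) + 0ℤ                   ≡⟨ cong₂ (λ x y → x + y + 0ℤ) (∑-*ˡ P c G) (∑-telescope P H-per (- 1ℤ)) ⟩
    c * ∑ P G + 0ℤ + 0ℤ                                                        ≡⟨ trans (ℤP.+-identityʳ _) (ℤP.+-identityʳ _) ⟩
    c * ∑ P G                                                                  ∎
    where open ≡-Reasoning

  -- The second square in each summand is chosen so that all cross terms telescope over a
  -- period; this exactness is what makes the constant 4·5 = 20 beat 81/4 in ∑-sq-tri-tri≤.
  module _ (P : ℕ) {x : ℤ → ℤ} (x-per : Periodic P x) where

    private
      x-per₁ : Periodic P (λ k → x (k - 1ℤ))
      x-per₁ = Periodic-translate P (- 1ℤ) x-per

    ∑-sq[x₀+x₁-x₂]+sq[x₀+x₂] : ∑ P (λ k → sq (x k + x (k - 1ℤ) - x (k - 1ℤ - 1ℤ)) + sq (x k + x (k - 1ℤ - 1ℤ))) ≡ + 5 * ∑ P (λ k → sq (x k))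
    ∑-sq[x₀+x₁-x₂]+sq[x₀+x₂] = ∑-modulo-telescopes P {H = λ y → sq (x y) - + 2 * (x y * x (y - 1ℤ))} {J = λ y → + 2 * sq (x y)} (+ 5)
      (λ k → cong₂ (λ a b → sq a - + 2 * (a * b)) (x-per k) (x-per₁ k))
      (λ k → cong (λ a → + 2 * sq a) (x-per k))
      (λ k → expand (x k) (x (k - 1ℤ)) (x (k - 1ℤ - 1ℤ)))
      where expand : ∀ a b c → (a + b - c) * (a + b - c) + (a + c) * (a + c)
                             ≡ + 5 * (a * a) + ((b * b - + 2 * (b * c)) - (a * a - + 2 * (a * b))) + (+ 2 * (c * c) - + 2 * (a * a))
            expand = solve-∀

    ∑-sq[-x₀+x₁+x₂]+sq[x₀+x₂] : ∑ P (λ k → sq (- x k + x (k - 1ℤ) + x (k - 1ℤ - 1ℤ)) + sq (x k + x (k - 1ℤ - 1ℤ))) ≡ + 5 * ∑ P (λ k → sq (x k))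
    ∑-sq[-x₀+x₁+x₂]+sq[x₀+x₂] = ∑-modulo-telescopes P {H = λ y → sq (x y) + + 2 * (x y * x (y - 1ℤ))} {J = λ y → + 2 * sq (x y)} (+ 5)
      (λ k → cong₂ (λ a b → sq a + + 2 * (a * b)) (x-per k) (x-per₁ k))
      (λ k → cong (λ a → + 2 * sq a) (x-per k))
      (λ k → expand (x k) (x (k - 1ℤ)) (x (k - 1ℤ - 1ℤ)))
      where expand : ∀ a b c → (- a + b + c) * (- a + b + c) + (a + c) * (a + c)
                             ≡ + 5 * (a * a) + ((b * b + + 2 * (b * c)) - (a * a + + 2 * (a * b))) + (+ 2 * (c * c) - + 2 * (a * a))
            expand = solve-∀

    ∑-sq[-x₀-x₁]+sq[x₀-x₁] : ∑ P (λ k → sq (- x k - x (k - 1ℤ)) + sq (x k - x (k - 1ℤ))) ≡ + 4 * ∑ P (λ k → sq (x k))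
    ∑-sq[-x₀-x₁]+sq[x₀-x₁] = ∑-modulo-telescopes P {H = λ y → + 2 * sq (x y)} {J = λ _ → 0ℤ} (+ 4)
      (λ k → cong (λ a → + 2 * sq a) (x-per k))
      (λ _ → refl)
      (λ k → expand (x k) (x (k - 1ℤ)))
      where expand : ∀ a b → (- a - b) * (- a - b) + (a - b) * (a - b) ≡ + 4 * (a * a) + (+ 2 * (b * b) - + 2 * (a * a)) + (0ℤ - 0ℤ)
            expand = solve-∀

  tri : ℤ → (ℤ → ℤ) → ℤ → ℤ
  tri u W ℓ = W (+ 2 * ℓ) + W (+ 2 * ℓ - + 2 * u) - W (+ 2 * ℓ - u)

  tri-cong : ∀ u {W W′ : ℤ → ℤ} → (∀ x → W x ≡ W′ x) → ∀ ℓ → tri u W ℓ ≡ tri u W′ ℓ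
  tri-cong u W≡W′ ℓ = cong₂ _-_ (cong₂ _+_ (W≡W′ _) (W≡W′ _)) (W≡W′ _)

  module Mod4 (W : ℤ → ℤ) where

    V : ℕ → ℤ → ℤ
    V φ k = W (+ 4 * k - + φ)

    tri-tri-residues : ∀ k → tri 1ℤ (tri (+ 3) W) k ≡
      (V 0 k + V 0 (k - 1ℤ) - V 0 (k - 1ℤ - 1ℤ)) + V 1 (k - 1ℤ) + (- V 2 k + V 2 (k - 1ℤ) + V 2 (k - 1ℤ - 1ℤ)) + (- V 3 k - V 3 (k - 1ℤ))
    tri-tri-residues k = begin
      tri 1ℤ (tri (+ 3) W) k
        ≡⟨ cong₂ _-_ (cong₂ _+_ (cong₂ _-_ (cong₂ _+_ (at 0 k (i₁ k)) (at 2 (k - 1ℤ) (i₂ k))) (at 3 k (i₃ k)))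
                               (cong₂ _-_ (cong₂ _+_ (at 0 (k - 1ℤ) (i₄ k)) (at 2 (k - 1ℤ - 1ℤ) (i₅ k))) (at 3 (k - 1ℤ) (i₆ k))))
                     (cong₂ _-_ (cong₂ _+_ (at 2 k (i₇ k)) (at 0 (k - 1ℤ - 1ℤ) (i₈ k))) (at 1 (k - 1ℤ) (i₉ k))) ⟩
      (a₀ + b₂ - a₃) + (b₀ + c₂ - b₃) - (a₂ + c₀ - b₁)
        ≡⟨ regroup a₀ b₀ c₀ b₁ a₂ b₂ c₂ a₃ b₃ ⟩
      (a₀ + b₀ - c₀) + b₁ + (- a₂ + b₂ + c₂) + (- a₃ - b₃)
        ∎
      where
      open ≡-Reasoning
      at : ∀ φ j {x} → x ≡ + 4 * j - + φ → W x ≡ V φ j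
      at φ j = cong W
      a₀ = V 0 k ; b₀ = V 0 (k - 1ℤ) ; c₀ = V 0 (k - 1ℤ - 1ℤ)
      b₁ = V 1 (k - 1ℤ)
      a₂ = V 2 k ; b₂ = V 2 (k - 1ℤ) ; c₂ = V 2 (k - 1ℤ - 1ℤ)
      a₃ = V 3 k ; b₃ = V 3 (k - 1ℤ)
      i₁ : ∀ k → + 2 * (+ 2 * k) ≡ + 4 * k - + 0
      i₁ = solve-∀
      i₂ : ∀ k → + 2 * (+ 2 * k) - + 2 * + 3 ≡ + 4 * (k - 1ℤ) - + 2
      i₂ = solve-∀
      i₃ : ∀ k → + 2 * (+ 2 * k) - + 3 ≡ + 4 * k - + 3
      i₃ = solve-∀
      i₄ : ∀ k → + 2 * (+ 2 * k - + 2 * 1ℤ) ≡ + 4 * (k - 1ℤ) - + 0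
      i₄ = solve-∀
      i₅ : ∀ k → + 2 * (+ 2 * k - + 2 * 1ℤ) - + 2 * + 3 ≡ + 4 * (k - 1ℤ - 1ℤ) - + 2
      i₅ = solve-∀
      i₆ : ∀ k → + 2 * (+ 2 * k - + 2 * 1ℤ) - + 3 ≡ + 4 * (k - 1ℤ) - + 3
      i₆ = solve-∀
      i₇ : ∀ k → + 2 * (+ 2 * k - 1ℤ) ≡ + 4 * k - + 2
      i₇ = solve-∀
      i₈ : ∀ k → + 2 * (+ 2 * k - 1ℤ) - + 2 * + 3 ≡ + 4 * (k - 1ℤ - 1ℤ) - + 0
      i₈ = solve-∀
      i₉ : ∀ k → + 2 * (+ 2 * k - 1ℤ) - + 3 ≡ + 4 * (k - 1ℤ) - + 1
      i₉ = solve-∀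
      regroup : ∀ a₀ b₀ c₀ b₁ a₂ b₂ c₂ a₃ b₃ → (a₀ + b₂ - a₃) + (b₀ + c₂ - b₃) - (a₂ + c₀ - b₁)
                                            ≡ (a₀ + b₀ - c₀) + b₁ + (- a₂ + b₂ + c₂) + (- a₃ - b₃)
      regroup = solve-∀

    Q₀ Q₁ Q₂ Q₃ : ℤ → ℤ
    Q₀ k = sq (V 0 k + V 0 (k - 1ℤ) - V 0 (k - 1ℤ - 1ℤ)) + sq (V 0 k + V 0 (k - 1ℤ - 1ℤ))
    Q₁ k = sq (V 1 (k - 1ℤ))
    Q₂ k = sq (- V 2 k + V 2 (k - 1ℤ) + V 2 (k - 1ℤ - 1ℤ)) + sq (V 2 k + V 2 (k - 1ℤ - 1ℤ))
    Q₃ k = sq (- V 3 k - V 3 (k - 1ℤ)) + sq (V 3 k - V 3 (k - 1ℤ))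

    sq-tri-tri≤ : ∀ k → sq (tri 1ℤ (tri (+ 3) W) k) ≤ + 4 * (Q₀ k + Q₁ k + Q₂ k + Q₃ k)
    sq-tri-tri≤ k = begin
      sq (tri 1ℤ (tri (+ 3) W) k)                     ≡⟨ cong sq (tri-tri-residues k) ⟩
      sq (p₀ + p₁ + p₂ + p₃)                          ≤⟨ sq-+₄ p₀ p₁ p₂ p₃ ⟩
      + 4 * (sq p₀ + sq p₁ + sq p₂ + sq p₃)           ≤⟨ ℤP.*-monoˡ-≤-nonNeg (+ 4)
                                                           (ℤP.+-mono-≤ (ℤP.+-mono-≤ (ℤP.+-mono-≤ (≤+sq (sq p₀) r₀) ℤP.≤-refl) (≤+sq (sq p₂) r₂))
                                                                        (≤+sq (sq p₃) r₃)) ⟩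
      + 4 * ((sq p₀ + sq r₀) + sq p₁ + (sq p₂ + sq r₂) + (sq p₃ + sq r₃)) ∎
      where
      open ℤP.≤-Reasoning
      ≤+sq : ∀ a r → a ≤ a + sq r
      ≤+sq a r = ≤-by-gap (sq r) refl (sq-nonNeg r)
      p₀ = V 0 k + V 0 (k - 1ℤ) - V 0 (k - 1ℤ - 1ℤ)
      p₁ = V 1 (k - 1ℤ)
      p₂ = - V 2 k + V 2 (k - 1ℤ) + V 2 (k - 1ℤ - 1ℤ)
      p₃ = - V 3 k - V 3 (k - 1ℤ)
      r₀ = V 0 k + V 0 (k - 1ℤ - 1ℤ)
      r₂ = V 2 k + V 2 (k - 1ℤ - 1ℤ)
      r₃ = V 3 k - V 3 (k - 1ℤ)

    module _ (P : ℕ) (W-per : Periodic (4 ℕ.* P) W) where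

      V-periodic : ∀ φ → Periodic P (V φ)
      V-periodic φ k = trans (cong W (trans (shift k (+ P) (+ φ)) (cong (λ z → + 4 * k - + φ + z) (sym (ℤP.pos-* 4 P)))))
                             (W-per (+ 4 * k - + φ))
        where shift : ∀ k p φ → + 4 * (k + p) - φ ≡ + 4 * k - φ + + 4 * p
              shift = solve-∀

      S : ℕ → ℤ
      S φ = ∑ P (λ k → sq (V φ k))

      ∑-sq-by-residues : ∑ (4 ℕ.* P) (λ x → sq (W x)) ≡ S 0 + S 1 + S 2 + S 3
      ∑-sq-by-residues = begin
        ∑ (4 ℕ.* P) (λ x → sq (W x))
          ≡⟨ cong (λ n → ∑ n (λ x → sq (W x))) (ℕP.*-comm 4 P) ⟩
        ∑ (P ℕ.* 4) (λ x → sq (W x))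
          ≡⟨ ∑-blocks 4 P (λ x → sq (W x)) ⟩
        ∑ P (λ b → 0ℤ + sq (W (+ 4 * b + + 0)) + sq (W (+ 4 * b + + 1)) + sq (W (+ 4 * b + + 2)) + sq (W (+ 4 * b + + 3)))
          ≡⟨ ∑-+₄ P _ _ _ _ ⟩
        ∑ P (λ b → 0ℤ + sq (W (+ 4 * b + + 0))) + ∑ P (λ b → sq (W (+ 4 * b + + 1)))
          + ∑ P (λ b → sq (W (+ 4 * b + + 2))) + ∑ P (λ b → sq (W (+ 4 * b + + 3)))
          ≡⟨ cong₂ _+_ (cong₂ _+_ (cong₂ _+_ (∑-cong P (λ b → ℤP.+-identityˡ _)) (wrap 1 3 i₁))
                                  (wrap 2 2 i₂))
                       (wrap 3 1 i₃) ⟩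
        S 0 + S 3 + S 2 + S 1
          ≡⟨ reorder (S 0) (S 1) (S 2) (S 3) ⟩
        S 0 + S 1 + S 2 + S 3
          ∎
        where
        open ≡-Reasoning
        wrap : ∀ j φ → (∀ b → + 4 * b + + j ≡ + 4 * (b + 1ℤ) - + φ) → ∑ P (λ b → sq (W (+ 4 * b + + j))) ≡ S φ
        wrap j φ e = trans (∑-cong P (λ b → cong (λ x → sq (W x)) (e b)))
                           (∑-translate P (λ k → cong sq (V-periodic φ k)) 1ℤ)
        i₁ : ∀ b → + 4 * b + + 1 ≡ + 4 * (b + 1ℤ) - + 3
        i₁ = solve-∀
        i₂ : ∀ b → + 4 * b + + 2 ≡ + 4 * (b + 1ℤ) - + 2
        i₂ = solve-∀
        i₃ : ∀ b → + 4 * b + + 3 ≡ + 4 * (b + 1ℤ) - + 1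
        i₃ = solve-∀
        reorder : ∀ a b c d → a + d + c + b ≡ a + b + c + d
        reorder = solve-∀

      ∑-sq-tri-tri≤ : ∑ P (λ k → sq (tri 1ℤ (tri (+ 3) W) k)) ≤ + 20 * ∑ (4 ℕ.* P) (λ x → sq (W x))
      ∑-sq-tri-tri≤ = begin
        ∑ P (λ k → sq (tri 1ℤ (tri (+ 3) W) k))
          ≤⟨ ∑-mono-≤ P sq-tri-tri≤ ⟩
        ∑ P (λ k → + 4 * (Q₀ k + Q₁ k + Q₂ k + Q₃ k))
          ≡⟨ ∑-*ˡ P (+ 4) _ ⟩
        + 4 * ∑ P (λ k → Q₀ k + Q₁ k + Q₂ k + Q₃ k)
          ≡⟨ cong (+ 4 *_) (∑-+₄ P Q₀ Q₁ Q₂ Q₃) ⟩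
        + 4 * (∑ P Q₀ + ∑ P Q₁ + ∑ P Q₂ + ∑ P Q₃)
          ≡⟨ cong (+ 4 *_) (cong₂ _+_ (cong₂ _+_ (cong₂ _+_ (∑-sq[x₀+x₁-x₂]+sq[x₀+x₂] P (V-periodic 0))
                                                            (∑-translate P (λ k → cong sq (V-periodic 1 k)) (- 1ℤ)))
                                                 (∑-sq[-x₀+x₁+x₂]+sq[x₀+x₂] P (V-periodic 2)))
                                      (∑-sq[-x₀-x₁]+sq[x₀-x₁] P (V-periodic 3))) ⟩
        + 4 * (+ 5 * S 0 + S 1 + + 5 * S 2 + + 4 * S 3)
          ≤⟨ ≤-by-gap (+ 16 * S 1 + + 4 * S 3) (slack (S 0) (S 1) (S 2) (S 3))
               (ℤP.+-mono-≤ (ℤP.*-monoˡ-≤-nonNeg (+ 16) (S-nonNeg 1)) (ℤP.*-monoˡ-≤-nonNeg (+ 4) (S-nonNeg 3))) ⟩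
        + 20 * (S 0 + S 1 + S 2 + S 3)
          ≡⟨ cong (+ 20 *_) ∑-sq-by-residues ⟨
        + 20 * ∑ (4 ℕ.* P) (λ x → sq (W x))
          ∎
        where
        open ℤP.≤-Reasoning
        S-nonNeg : ∀ φ → 0ℤ ≤ S φ
        S-nonNeg φ = ∑-nonNeg P (λ k → sq-nonNeg (V φ k))
        slack : ∀ a b c d → + 20 * (a + b + c + d) ≡ + 4 * (+ 5 * a + b + + 5 * c + + 4 * d) + (+ 16 * b + + 4 * d)
        slack = solve-∀

module NatFacts where

  open import Data.Nat
  open import Data.Nat.Properties
  open import Data.Nat.Tactic.RingSolver using (solve-∀)
  open import Relation.Binary.PropositionalEquality
  open import Relation.Nullary using (yes; no; contradiction)

  ^-distribʳ-* : ∀ a b n → (a * b) ^ n ≡ a ^ n * b ^ n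
  ^-distribʳ-* a b zero    = refl
  ^-distribʳ-* a b (suc n) = trans (cong (a * b *_) (^-distribʳ-* a b n)) (shuffle a b (a ^ n) (b ^ n))
    where shuffle : ∀ a b x y → a * b * (x * y) ≡ a * x * (b * y)
          shuffle = solve-∀

  bernoulli : ∀ a L → a ^ L * (a + L) ≤ a * suc a ^ L
  bernoulli a zero    = ≤-reflexive (base a)
    where base : ∀ a → 1 * (a + 0) ≡ a * 1
          base = solve-∀
  bernoulli a (suc L) = begin
    a ^ suc L * (a + suc L)           ≡⟨ expand a (a ^ L) L ⟩
    a * (a ^ L * (a + L)) + a ^ L * a ≤⟨ +-monoʳ-≤ (a * (a ^ L * (a + L))) (*-monoʳ-≤ (a ^ L) (m≤m+n a L)) ⟩
    a * (a ^ L * (a + L)) + a ^ L * (a + L) ≡⟨ +-comm (a * (a ^ L * (a + L))) _ ⟩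
    suc a * (a ^ L * (a + L))         ≤⟨ *-monoʳ-≤ (suc a) (bernoulli a L) ⟩
    suc a * (a * suc a ^ L)           ≡⟨ regroup a (suc a ^ L) ⟩
    a * suc a ^ suc L                 ∎
    where
    open ≤-Reasoning
    expand : ∀ a x L → a * x * (a + suc L) ≡ a * (x * (a + L)) + x * a
    expand = solve-∀
    regroup : ∀ a y → suc a * (a * y) ≡ a * (suc a * y)
    regroup = solve-∀

  *-^-≤-suc-^ : ∀ a c .{{_ : NonZero a}} → c * a ^ (a * c) ≤ suc a ^ (a * c)
  *-^-≤-suc-^ a c = *-cancelˡ-≤ a (begin
    a * (c * a ^ L)        ≤⟨ *-monoʳ-≤ a (*-monoˡ-≤ (a ^ L) (n≤1+n c)) ⟩
    a * (suc c * a ^ L)    ≡⟨ regroup a c (a ^ L) ⟩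
    a ^ L * (a + a * c)    ≤⟨ bernoulli a L ⟩
    a * suc a ^ L          ∎)
    where
    open ≤-Reasoning
    L = a * c
    regroup : ∀ a c x → a * (suc c * x) ≡ x * (a + a * c)
    regroup = solve-∀

  m*m≤n*n⇒m≤n : ∀ {m n} → m * m ≤ n * n → m ≤ n
  m*m≤n*n⇒m≤n {m} {n} m²≤n² with m ≤? n
  ... | yes m≤n = m≤n
  ... | no  m≰n = contradiction m²≤n² (<⇒≱ (*-mono-< (≰⇒> m≰n) (≰⇒> m≰n)))

  2qd≤N : ∀ {P B A q d M N} .{{_ : NonZero P}} →
          P * (d * d) ≤ B * ((M + P) * M) → 8 * (q * q) * B ≤ A * A →
          A * M ≤ N → M ≤ N → 8 * (q * q) * B * P ≤ N → 2 * q * d ≤ N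
  2qd≤N {P} {B} {A} {q} {d} {M} {N} d²≤ 8q²B≤A² AM≤N M≤N 8q²BP≤N = m*m≤n*n⇒m≤n (*-cancelˡ-≤ 2 (begin
    2 * (2 * q * d * (2 * q * d))                 ≡⟨ square q d ⟩
    8 * (q * q) * (d * d)                         ≤⟨ *-monoʳ-≤ (8 * (q * q)) (m≤n*m (d * d) P) ⟩
    8 * (q * q) * (P * (d * d))                   ≤⟨ *-monoʳ-≤ (8 * (q * q)) d²≤ ⟩
    8 * (q * q) * (B * ((M + P) * M))             ≡⟨ spread (8 * (q * q)) B M P ⟩
    8 * (q * q) * B * (M * M) + 8 * (q * q) * B * P * M ≤⟨ +-mono-≤ (*-monoˡ-≤ (M * M) 8q²B≤A²) (*-monoˡ-≤ M 8q²BP≤N) ⟩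
    A * A * (M * M) + N * M                       ≡⟨ cong (_+ N * M) (interchange A M) ⟩
    A * M * (A * M) + N * M                       ≤⟨ +-mono-≤ (*-mono-≤ AM≤N AM≤N) (*-monoʳ-≤ N M≤N) ⟩
    N * N + N * N                                 ≡⟨ double (N * N) ⟩
    2 * (N * N)                                   ∎))
    where
    open ≤-Reasoning
    square : ∀ q d → 2 * (2 * q * d * (2 * q * d)) ≡ 8 * (q * q) * (d * d)
    square = solve-∀
    spread : ∀ c B M P → c * (B * ((M + P) * M)) ≡ c * B * (M * M) + c * B * P * M
    spread = solve-∀
    interchange : ∀ A M → A * A * (M * M) ≡ A * M * (A * M)
    interchange = solve-∀
    double : ∀ x → x + x ≡ 2 * x
    double = solve-∀

module RationalBound where

  open import Data.Nat as ℕ using (ℕ; zero; suc; NonZero)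
  import Data.Nat.Properties as ℕP
  open import Data.Integer as ℤ using (ℤ; +_; -[1+_]; +<+; ∣_∣)
  import Data.Integer.Properties as ℤP
  open import Data.Integer.Tactic.RingSolver using (solve-∀)
  open import Data.Nat.Tactic.RingSolver using () renaming (solve-∀ to ℕ-solve-∀)
  open import Data.Rational as ℚ using (ℚ; mkℚ; 0ℚ; _/_; _-_; _<_; *<*; toℚᵘ; ↧ₙ_)
  import Data.Rational.Properties as ℚP
  open import Data.Rational.Unnormalised as ℚᵘ using (ℚᵘ; mkℚᵘ; _≃_)
  import Data.Rational.Unnormalised.Properties as ℚᵘP
  open import Relation.Binary.PropositionalEquality

  toℚᵘ-∣x/N-y/D∣ : ∀ x y M D′ → toℚᵘ (ℚ.∣ x / suc M - y / suc D′ ∣) ≃ ℚᵘ.∣ mkℚᵘ x M ℚᵘ.- mkℚᵘ y D′ ∣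
  toℚᵘ-∣x/N-y/D∣ x y M D′ = begin
    toℚᵘ ℚ.∣ a - b ∣                 ≈⟨ ℚP.toℚᵘ-homo-∣-∣ (a - b) ⟩
    ℚᵘ.∣ toℚᵘ (a - b) ∣              ≈⟨ ℚᵘP.∣-∣-cong (ℚP.toℚᵘ-homo-+ a (ℚ.- b)) ⟩
    ℚᵘ.∣ toℚᵘ a ℚᵘ.+ toℚᵘ (ℚ.- b) ∣  ≈⟨ ℚᵘP.∣-∣-cong (ℚᵘP.+-cong (ℚP.toℚᵘ-fromℚᵘ (mkℚᵘ x M))
                                                                (ℚᵘP.≃-trans (ℚP.toℚᵘ-homo‿- b) (ℚᵘP.-‿cong (ℚP.toℚᵘ-fromℚᵘ (mkℚᵘ y D′))))) ⟩
    ℚᵘ.∣ mkℚᵘ x M ℚᵘ.- mkℚᵘ y D′ ∣   ∎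
    where
    open ℚᵘP.≃-Reasoning
    a = x / suc M
    b = y / suc D′

  -- ε = p / q with p ≥ 1, so ε ≥ 1 / q, while the hypothesis bounds the distance by 1 / (2 q).
  ∣x/N-1/2P∣<ε : ∀ x M P .{{_ : NonZero P}} (ε : ℚ) → 0ℚ < ε →
                 ↧ₙ ε ℕ.* ∣ + (2 ℕ.* P) ℤ.* + x ℤ.- + suc M ∣ ℕ.≤ P ℕ.* suc M →
                 ℚ.∣ + x / suc M - _/_ (+ 1) (2 ℕ.* P) {{ℕP.m*n≢0 2 P}} ∣ < ε
  ∣x/N-1/2P∣<ε x M (suc P′) (mkℚ (+ zero)  _ _) (*<* (+<+ ()))
  ∣x/N-1/2P∣<ε x M (suc P′) (mkℚ -[1+ _ ]  _ _) (*<* ())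
  ∣x/N-1/2P∣<ε x M (suc P′) ε@(mkℚ (+ suc p) q-1 _) _ q∣E∣≤PN =
    ℚP.toℚᵘ-cancel-< (ℚᵘP.<-respˡ-≃ (ℚᵘP.≃-sym (toℚᵘ-∣x/N-y/D∣ (+ x) (+ 1) M _)) (ℚᵘ.*<* key))
    where
    P = suc P′
    N = suc M
    D = 2 ℕ.* P
    q = suc q-1
    E = + D ℤ.* + x ℤ.- + N
    E′≡E : + x ℤ.* + D ℤ.+ -[1+ 0 ] ℤ.* + N ≡ E
    E′≡E = reorder (+ x) (+ D) (+ N)
      where reorder : ∀ x D N → x ℤ.* D ℤ.+ -[1+ 0 ] ℤ.* N ≡ D ℤ.* x ℤ.- N
            reorder = solve-∀
    key : + ∣ + x ℤ.* + D ℤ.+ -[1+ 0 ] ℤ.* + N ∣ ℤ.* + q ℤ.< + suc p ℤ.* + (N ℕ.* D)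
    key = subst₂ ℤ._<_ (trans (ℤP.pos-* ∣ E ∣ q) (cong (λ e → + ∣ e ∣ ℤ.* + q) (sym E′≡E))) (ℤP.pos-* (suc p) (N ℕ.* D))
                 (+<+ (begin-strict
      ∣ E ∣ ℕ.* q          ≡⟨ ℕP.*-comm ∣ E ∣ q ⟩
      q ℕ.* ∣ E ∣          ≤⟨ q∣E∣≤PN ⟩
      P ℕ.* N              <⟨ ℕP.m<m+n (P ℕ.* N) (ℕP.*-mono-≤ {1} {P} {1} {N} (ℕ.s≤s ℕ.z≤n) (ℕ.s≤s ℕ.z≤n)) ⟩
      P ℕ.* N ℕ.+ P ℕ.* N  ≡⟨ double P N ⟩
      N ℕ.* D              ≤⟨ ℕP.m≤n*m (N ℕ.* D) (suc p) ⟩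
      suc p ℕ.* (N ℕ.* D)  ∎))
      where
      open ℕP.≤-Reasoning
      double : ∀ P N → P ℕ.* N ℕ.+ P ℕ.* N ≡ N ℕ.* (2 ℕ.* P)
      double = ℕ-solve-∀

module Recurrence where

  open import Data.Bool using (Bool; not)
  open import Data.Nat as ℕ using (ℕ)
  open import Data.Product using (_×_)
  open import Relation.Binary.PropositionalEquality

  Recurrence32 : (ℕ → Bool) → Set
  Recurrence32 t = ∀ n → t (3 ℕ.* n) ≡ t (2 ℕ.* n)
                       × t (3 ℕ.* n ℕ.+ 1) ≡ t (2 ℕ.* n)
                       × t (3 ℕ.* n ℕ.+ 2) ≡ not (t (2 ℕ.* n ℕ.+ 1))

open Recurrence using (Recurrence32)

module Discrepancy (t : ℕ → Bool) (rec : Recurrence32 t) where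

  open import Data.Bool using (Bool; true; false; not; if_then_else_)
  open import Data.Nat as ℕ using (ℕ; zero; suc; _^_)
  open import Relation.Binary.PropositionalEquality
  import Data.Nat.Properties as ℕP
  open import Data.Integer using (ℤ; +_; _+_; _*_; _-_; -_; 0ℤ; 1ℤ; -1ℤ; _≤_; ∣_∣)
  open import Data.Integer.Divisibility.Signed using (divides)
  import Data.Integer.Properties as ℤP
  open import Data.Integer.Tactic.RingSolver using (solve-∀)
  open import Data.Product using (proj₁; proj₂)
  open IntegerFacts using (+[r+k*j])
  open IntegerSums
  open TwoStepEnergy
  open ResidueCounts
  open PowerOfTwoIndicator

  sgn : Bool → ℤ
  sgn b = if b then - 1ℤ else 1ℤ

  sgn-not : ∀ b → sgn (not b) ≡ - sgn b
  sgn-not true  = refl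
  sgn-not false = refl

  ∣sgn∣≡1 : ∀ b → ∣ sgn b ∣ ≡ 1
  ∣sgn∣≡1 true  = refl
  ∣sgn∣≡1 false = refl

  σ : ℕ → ℤ
  σ i = sgn (t i)

  σ-3n : ∀ n → σ (3 ℕ.* n) ≡ σ (2 ℕ.* n)
  σ-3n n = cong sgn (proj₁ (rec n))

  σ-3n+1 : ∀ n → σ (1 ℕ.+ 3 ℕ.* n) ≡ σ (2 ℕ.* n)
  σ-3n+1 n = cong sgn (trans (cong t (ℕP.+-comm 1 (3 ℕ.* n))) (proj₁ (proj₂ (rec n))))

  σ-3n+2 : ∀ n → σ (2 ℕ.+ 3 ℕ.* n) ≡ - σ (1 ℕ.+ 2 ℕ.* n)
  σ-3n+2 n = begin
    σ (2 ℕ.+ 3 ℕ.* n)                              ≡⟨ cong σ (ℕP.+-comm 2 (3 ℕ.* n)) ⟩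
    σ (3 ℕ.* n ℕ.+ 2)                              ≡⟨ cong sgn (proj₂ (proj₂ (rec n))) ⟩
    sgn (not (t (2 ℕ.* n ℕ.+ 1)))                  ≡⟨ sgn-not (t (2 ℕ.* n ℕ.+ 1)) ⟩
    - σ (2 ℕ.* n ℕ.+ 1)                            ≡⟨ cong (λ i → - σ i) (ℕP.+-comm (2 ℕ.* n) 1) ⟩
    - σ (1 ℕ.+ 2 ℕ.* n)                            ∎
    where open ≡-Reasoning

  term : ℤ → ℕ → ℤ → ℕ → ℤ
  term u m ℓ i = [2^ m ∣ u * + i - ℓ ] * σ i

  -- Δ u m ℓ N sums σ i over i < N with u·i ≡ ℓ (mod 2^m); the odd multiplier u = 3^p records
  -- how often the recurrence has been applied (Δ-triple), and Δ 1ℤ is the discrepancy itself.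
  Δ : ℤ → ℕ → ℤ → ℕ → ℤ
  Δ u m ℓ N = ∑ N (λ x → [2^ m ∣ u * x - ℓ ] * σ ∣ x ∣)

  Δ₁-≡ : ∀ m ℓ N → Δ 1ℤ m ℓ N ≡ ∑ N (λ x → [2^ m ∣ x - ℓ ] * σ ∣ x ∣)
  Δ₁-≡ m ℓ N = ∑-cong N (λ x → cong (λ y → [2^ m ∣ y - ℓ ] * σ ∣ x ∣) (ℤP.*-identityˡ x))

  term-odd : ∀ u m ℓ i w → u * + i - ℓ ≡ + 2 * w + 1ℤ → term u (suc m) ℓ i ≡ 0ℤ
  term-odd u m ℓ i w arg≡ =
    trans (cong (λ a → [2^ suc m ∣ a ] * σ i) arg≡)
          (trans (cong (_* σ i) ([2^∣]-odd m w)) (ℤP.*-zeroˡ (σ i)))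

  module TripleBlock (v : ℤ) (m : ℕ) (ℓ : ℤ) (j : ℕ) where

    open ≡-Reasoning

    u : ℤ
    u = 1ℤ + + 2 * v

    term′ : ℤ → ℕ → ℤ
    term′ = term (+ 3 * u) (suc m)

    2j 3j : ℤ
    2j = + 2 * + j
    3j = + 3 * + j

    +2j : + (2 ℕ.* j) ≡ 2j
    +2j = ℤP.pos-* 2 j

    +3j : + (3 ℕ.* j) ≡ 3j
    +3j = ℤP.pos-* 3 j

    term-3j : term u m ℓ (3 ℕ.* j) ≡ term′ (+ 2 * ℓ) (2 ℕ.* j)
    term-3j = cong₂ _*_ (sym ([2^∣]-double′ m arg)) (σ-3n j)
      where
      ring : ∀ v j ℓ → + 3 * (1ℤ + + 2 * v) * (+ 2 * j) - + 2 * ℓ ≡ + 2 * ((1ℤ + + 2 * v) * (+ 3 * j) - ℓ)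
      ring = solve-∀
      arg : + 3 * u * + (2 ℕ.* j) - + 2 * ℓ ≡ + 2 * (u * + (3 ℕ.* j) - ℓ)
      arg = begin
        + 3 * u * + (2 ℕ.* j) - + 2 * ℓ  ≡⟨ cong (λ x → + 3 * u * x - + 2 * ℓ) +2j ⟩
        + 3 * u * 2j - + 2 * ℓ           ≡⟨ ring v (+ j) ℓ ⟩
        + 2 * (u * 3j - ℓ)               ≡⟨ cong (λ x → + 2 * (u * x - ℓ)) +3j ⟨
        + 2 * (u * + (3 ℕ.* j) - ℓ)      ∎

    +1+2j : + (1 ℕ.+ 2 ℕ.* j) ≡ 1ℤ + 2j
    +1+2j = +[r+k*j] 1 2 j

    +1+3j : + (1 ℕ.+ 3 ℕ.* j) ≡ 1ℤ + 3j
    +1+3j = +[r+k*j] 1 3 j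

    +2+3j : + (2 ℕ.+ 3 ℕ.* j) ≡ + 2 + 3j
    +2+3j = +[r+k*j] 2 3 j

    term-3j+1 : term u m ℓ (1 ℕ.+ 3 ℕ.* j) ≡ term′ (+ 2 * ℓ - + 2 * u) (2 ℕ.* j)
    term-3j+1 = cong₂ _*_ (sym ([2^∣]-double′ m arg)) (σ-3n+1 j)
      where
      ring : ∀ v j ℓ → + 3 * (1ℤ + + 2 * v) * (+ 2 * j) - (+ 2 * ℓ - + 2 * (1ℤ + + 2 * v))
                     ≡ + 2 * ((1ℤ + + 2 * v) * (1ℤ + + 3 * j) - ℓ)
      ring = solve-∀
      arg : + 3 * u * + (2 ℕ.* j) - (+ 2 * ℓ - + 2 * u) ≡ + 2 * (u * + (1 ℕ.+ 3 ℕ.* j) - ℓ)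
      arg = begin
        + 3 * u * + (2 ℕ.* j) - (+ 2 * ℓ - + 2 * u)  ≡⟨ cong (λ x → + 3 * u * x - (+ 2 * ℓ - + 2 * u)) +2j ⟩
        + 3 * u * 2j - (+ 2 * ℓ - + 2 * u)           ≡⟨ ring v (+ j) ℓ ⟩
        + 2 * (u * (1ℤ + 3j) - ℓ)                    ≡⟨ cong (λ x → + 2 * (u * x - ℓ)) +1+3j ⟨
        + 2 * (u * + (1 ℕ.+ 3 ℕ.* j) - ℓ)            ∎

    term-3j+2 : term u m ℓ (2 ℕ.+ 3 ℕ.* j) ≡ - term′ (+ 2 * ℓ - u) (1 ℕ.+ 2 ℕ.* j)
    term-3j+2 = begin
      [2^ m ∣ u * + (2 ℕ.+ 3 ℕ.* j) - ℓ ] * σ (2 ℕ.+ 3 ℕ.* j)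
        ≡⟨ cong₂ _*_ (sym ([2^∣]-double′ m arg)) (σ-3n+2 j) ⟩
      [2^ suc m ∣ + 3 * u * + (1 ℕ.+ 2 ℕ.* j) - (+ 2 * ℓ - u) ] * - σ (1 ℕ.+ 2 ℕ.* j)
        ≡⟨ ℤP.neg-distribʳ-* [2^ suc m ∣ + 3 * u * + (1 ℕ.+ 2 ℕ.* j) - (+ 2 * ℓ - u) ] (σ (1 ℕ.+ 2 ℕ.* j)) ⟨
      - term′ (+ 2 * ℓ - u) (1 ℕ.+ 2 ℕ.* j)
        ∎
      where
      ring : ∀ v j ℓ → + 3 * (1ℤ + + 2 * v) * (1ℤ + + 2 * j) - (+ 2 * ℓ - (1ℤ + + 2 * v))
                     ≡ + 2 * ((1ℤ + + 2 * v) * (+ 2 + + 3 * j) - ℓ)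
      ring = solve-∀
      arg : + 3 * u * + (1 ℕ.+ 2 ℕ.* j) - (+ 2 * ℓ - u) ≡ + 2 * (u * + (2 ℕ.+ 3 ℕ.* j) - ℓ)
      arg = begin
        + 3 * u * + (1 ℕ.+ 2 ℕ.* j) - (+ 2 * ℓ - u)  ≡⟨ cong (λ x → + 3 * u * x - (+ 2 * ℓ - u)) +1+2j ⟩
        + 3 * u * (1ℤ + 2j) - (+ 2 * ℓ - u)          ≡⟨ ring v (+ j) ℓ ⟩
        + 2 * (u * (+ 2 + 3j) - ℓ)                   ≡⟨ cong (λ x → + 2 * (u * x - ℓ)) +2+3j ⟨
        + 2 * (u * + (2 ℕ.+ 3 ℕ.* j) - ℓ)            ∎

    term′-2ℓ-odd≡0 : term′ (+ 2 * ℓ) (1 ℕ.+ 2 ℕ.* j) ≡ 0ℤ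
    term′-2ℓ-odd≡0 = term-odd (+ 3 * u) m (+ 2 * ℓ) (1 ℕ.+ 2 ℕ.* j) (u * 3j + + 3 * v + 1ℤ - ℓ)
      (trans (cong (λ x → + 3 * u * x - + 2 * ℓ) +1+2j) (ring v (+ j) ℓ))
      where ring : ∀ v j ℓ → + 3 * (1ℤ + + 2 * v) * (1ℤ + + 2 * j) - + 2 * ℓ
                           ≡ + 2 * ((1ℤ + + 2 * v) * (+ 3 * j) + + 3 * v + 1ℤ - ℓ) + 1ℤ
            ring = solve-∀

    term′-2ℓ-2u-odd≡0 : term′ (+ 2 * ℓ - + 2 * u) (1 ℕ.+ 2 ℕ.* j) ≡ 0ℤ
    term′-2ℓ-2u-odd≡0 = term-odd (+ 3 * u) m (+ 2 * ℓ - + 2 * u) (1 ℕ.+ 2 ℕ.* j) (u * 3j + + 5 * v + + 2 - ℓ)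
      (trans (cong (λ x → + 3 * u * x - (+ 2 * ℓ - + 2 * u)) +1+2j) (ring v (+ j) ℓ))
      where ring : ∀ v j ℓ → + 3 * (1ℤ + + 2 * v) * (1ℤ + + 2 * j) - (+ 2 * ℓ - + 2 * (1ℤ + + 2 * v))
                           ≡ + 2 * ((1ℤ + + 2 * v) * (+ 3 * j) + + 5 * v + + 2 - ℓ) + 1ℤ
            ring = solve-∀

    term′-2ℓ-u-even≡0 : term′ (+ 2 * ℓ - u) (2 ℕ.* j) ≡ 0ℤ
    term′-2ℓ-u-even≡0 = term-odd (+ 3 * u) m (+ 2 * ℓ - u) (2 ℕ.* j) (u * 3j + v - ℓ)
      (trans (cong (λ x → + 3 * u * x - (+ 2 * ℓ - u)) +2j) (ring v (+ j) ℓ))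
      where ring : ∀ v j ℓ → + 3 * (1ℤ + + 2 * v) * (+ 2 * j) - (+ 2 * ℓ - (1ℤ + + 2 * v))
                           ≡ + 2 * ((1ℤ + + 2 * v) * (+ 3 * j) + v - ℓ) + 1ℤ
            ring = solve-∀

  Δ-triple : ∀ v m ℓ M → let u = 1ℤ + + 2 * v in
             Δ u m ℓ (3 ℕ.* M) ≡ tri u (λ x → Δ (+ 3 * u) (suc m) x (2 ℕ.* M)) ℓ
  Δ-triple v m ℓ zero    = refl
  Δ-triple v m ℓ (suc M) = begin
    Δ u m ℓ (3 ℕ.* suc M)
      ≡⟨ cong (Δ u m ℓ) (ℕP.*-suc 3 M) ⟩
    Δ u m ℓ (3 ℕ.* M) + term u m ℓ (3 ℕ.* M) + term u m ℓ (1 ℕ.+ 3 ℕ.* M) + term u m ℓ (2 ℕ.+ 3 ℕ.* M)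
      ≡⟨ cong₂ _+_ (cong₂ _+_ (cong₂ _+_ (Δ-triple v m ℓ M) term-3j) term-3j+1) term-3j+2 ⟩
    Y + Z - W + term′ ℓ₁ (2 ℕ.* M) + term′ ℓ₂ (2 ℕ.* M) + - term′ ℓ₃ (1 ℕ.+ 2 ℕ.* M)
      ≡⟨ regroup Y Z W (term′ ℓ₁ (2 ℕ.* M)) (term′ ℓ₂ (2 ℕ.* M)) (term′ ℓ₃ (1 ℕ.+ 2 ℕ.* M)) ⟩
    (Y + term′ ℓ₁ (2 ℕ.* M) + 0ℤ) + (Z + term′ ℓ₂ (2 ℕ.* M) + 0ℤ) - (W + 0ℤ + term′ ℓ₃ (1 ℕ.+ 2 ℕ.* M))
      ≡⟨ cong₂ _-_ (cong₂ _+_ (cong (λ x → Y + term′ ℓ₁ (2 ℕ.* M) + x) term′-2ℓ-odd≡0)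
                              (cong (λ x → Z + term′ ℓ₂ (2 ℕ.* M) + x) term′-2ℓ-2u-odd≡0))
                   (cong (λ x → W + x + term′ ℓ₃ (1 ℕ.+ 2 ℕ.* M)) term′-2ℓ-u-even≡0) ⟨
    Δ′ ℓ₁ (2 ℕ.+ 2 ℕ.* M) + Δ′ ℓ₂ (2 ℕ.+ 2 ℕ.* M) - Δ′ ℓ₃ (2 ℕ.+ 2 ℕ.* M)
      ≡⟨ cong (λ n → Δ′ ℓ₁ n + Δ′ ℓ₂ n - Δ′ ℓ₃ n) (ℕP.*-suc 2 M) ⟨
    Δ′ ℓ₁ (2 ℕ.* suc M) + Δ′ ℓ₂ (2 ℕ.* suc M) - Δ′ ℓ₃ (2 ℕ.* suc M)
      ∎
    where
    open ≡-Reasoning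
    open TripleBlock v m ℓ M
    Δ′ : ℤ → ℕ → ℤ
    Δ′ = Δ (+ 3 * u) (suc m)
    ℓ₁ ℓ₂ ℓ₃ Y Z W : ℤ
    ℓ₁ = + 2 * ℓ
    ℓ₂ = + 2 * ℓ - + 2 * u
    ℓ₃ = + 2 * ℓ - u
    Y = Δ′ ℓ₁ (2 ℕ.* M)
    Z = Δ′ ℓ₂ (2 ℕ.* M)
    W = Δ′ ℓ₃ (2 ℕ.* M)
    regroup : ∀ Y Z W a b c → Y + Z - W + a + b + - c ≡ (Y + a + 0ℤ) + (Z + b + 0ℤ) - (W + 0ℤ + c)
    regroup = solve-∀

  Δ-nine : ∀ m k M → Δ 1ℤ m k (9 ℕ.* M) ≡ tri 1ℤ (tri (+ 3) (λ x → Δ (+ 9) (2 ℕ.+ m) x (4 ℕ.* M))) k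
  Δ-nine m k M = begin
    Δ 1ℤ m k (9 ℕ.* M)                                                   ≡⟨ cong (Δ 1ℤ m k) (ℕP.*-assoc 3 3 M) ⟩
    Δ 1ℤ m k (3 ℕ.* (3 ℕ.* M))                                           ≡⟨ Δ-triple 0ℤ m k (3 ℕ.* M) ⟩
    tri 1ℤ (λ x → Δ (+ 3) (suc m) x (2 ℕ.* (3 ℕ.* M))) k                 ≡⟨ cong (λ n → tri 1ℤ (λ x → Δ (+ 3) (suc m) x n) k) 2*3M≡3*2M ⟩
    tri 1ℤ (λ x → Δ (+ 3) (suc m) x (3 ℕ.* (2 ℕ.* M))) k                 ≡⟨ tri-cong 1ℤ (λ x → Δ-triple 1ℤ (suc m) x (2 ℕ.* M)) k ⟩
    tri 1ℤ (tri (+ 3) (λ x → Δ (+ 9) (2 ℕ.+ m) x (2 ℕ.* (2 ℕ.* M)))) k   ≡⟨ cong (λ n → tri 1ℤ (tri (+ 3) (λ x → Δ (+ 9) (2 ℕ.+ m) x n)) k) (ℕP.*-assoc 2 2 M) ⟨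
    tri 1ℤ (tri (+ 3) (λ x → Δ (+ 9) (2 ℕ.+ m) x (4 ℕ.* M))) k           ∎
    where open ≡-Reasoning
          2*3M≡3*2M : 2 ℕ.* (3 ℕ.* M) ≡ 3 ℕ.* (2 ℕ.* M)
          2*3M≡3*2M = trans (sym (ℕP.*-assoc 2 3 M)) (ℕP.*-assoc 3 2 M)

  Δ-periodic : ∀ u m N → Periodic (2 ^ m) (λ ℓ → Δ u m ℓ N)
  Δ-periodic u m N ℓ = ∑-cong N (λ x → cong (_* σ ∣ x ∣) ([2^∣]-≡-mod m (divides -1ℤ (difference (u * x) ℓ (+ (2 ^ m))))))
    where difference : ∀ a ℓ P → a - (ℓ + P) - (a - ℓ) ≡ - 1ℤ * P
          difference = solve-∀

  Δ-odd-* : ∀ v m x N → Δ (1ℤ + + 2 * v) m ((1ℤ + + 2 * v) * x) N ≡ Δ 1ℤ m x N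
  Δ-odd-* v m x N = ∑-cong N (λ i → cong (_* σ ∣ i ∣) (trans (cong [2^ m ∣_] (factor (1ℤ + + 2 * v) i x)) ([2^∣]-odd-* m v (1ℤ * i - x))))
    where factor : ∀ u i x → u * i - u * x ≡ u * (1ℤ * i - x)
          factor = solve-∀

  ∣[2^∣]*σ∣ : ∀ m x i → + ∣ [2^ m ∣ x ] * σ i ∣ ≡ [2^ m ∣ x ]
  ∣[2^∣]*σ∣ m x i = begin
    + ∣ [2^ m ∣ x ] * σ i ∣           ≡⟨ cong +_ (ℤP.∣i*j∣≡∣i∣*∣j∣ [2^ m ∣ x ] (σ i)) ⟩
    + (∣ [2^ m ∣ x ] ∣ ℕ.* ∣ σ i ∣)   ≡⟨ cong (λ n → + (∣ [2^ m ∣ x ] ∣ ℕ.* n)) (∣sgn∣≡1 (t i)) ⟩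
    + (∣ [2^ m ∣ x ] ∣ ℕ.* 1)         ≡⟨ cong +_ (ℕP.*-identityʳ _) ⟩
    + ∣ [2^ m ∣ x ] ∣                 ≡⟨ ℤP.0≤i⇒+∣i∣≡i (proj₁ ([2^∣]-bounded m x)) ⟩
    [2^ m ∣ x ]                       ∎
    where open ≡-Reasoning

  ∣Δ∣≤count≡ : ∀ m ℓ N → + ∣ Δ 1ℤ m ℓ N ∣ ≤ count≡ m ℓ N
  ∣Δ∣≤count≡ m ℓ N = subst (λ D → + ∣ D ∣ ≤ count≡ m ℓ N) (sym (Δ₁-≡ m ℓ N))
                            (∣∑∣≤∑ N (λ x → ℤP.≤-reflexive (∣[2^∣]*σ∣ m (x - ℓ) ∣ x ∣)))

  ∣Δ-++∣≤ : ∀ u m ℓ a r → ∣ Δ u m ℓ (a ℕ.+ r) ∣ ℕ.≤ ∣ Δ u m ℓ a ∣ ℕ.+ r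
  ∣Δ-++∣≤ u m ℓ a r = begin
    ∣ Δ u m ℓ (a ℕ.+ r) ∣                ≡⟨ cong ∣_∣ (∑-++ a r _) ⟩
    ∣ Δ u m ℓ a + tail ∣                 ≤⟨ ℤP.∣i+j∣≤∣i∣+∣j∣ (Δ u m ℓ a) tail ⟩
    ∣ Δ u m ℓ a ∣ ℕ.+ ∣ tail ∣           ≤⟨ ℕP.+-monoʳ-≤ ∣ Δ u m ℓ a ∣ (ℤP.drop‿+≤+ ∣tail∣≤r) ⟩
    ∣ Δ u m ℓ a ∣ ℕ.+ r                  ∎
    where
    open ℕP.≤-Reasoning
    tail = ∑ r (λ x → [2^ m ∣ u * (x + + a) - ℓ ] * σ ∣ x + + a ∣)
    ∣tail∣≤r : + ∣ tail ∣ ≤ + r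
    ∣tail∣≤r = subst (+ ∣ tail ∣ ≤_) (∑-one r) (∣∑∣≤∑ r ∣term∣≤1)
      where ∣term∣≤1 : ∀ x → + ∣ [2^ m ∣ u * (x + + a) - ℓ ] * σ ∣ x + + a ∣ ∣ ≤ 1ℤ
            ∣term∣≤1 x = subst (_≤ 1ℤ) (sym (∣[2^∣]*σ∣ m _ _)) (proj₂ ([2^∣]-bounded m _))

module DiscrepancyEnergy (t : ℕ → Bool) (rec : Recurrence32 t) where

  open import Data.Nat as ℕ using (ℕ; zero; suc; _^_)
  open import Relation.Binary.PropositionalEquality
  import Data.Nat.Properties as ℕP
  open import Data.Integer using (ℤ; +_; _+_; _*_; 1ℤ; _≤_; ∣_∣; nonNegative)
  import Data.Integer.Properties as ℤP
  open import Data.Integer.Tactic.RingSolver using (solve-∀)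
  open import Data.Nat.Tactic.RingSolver using () renaming (solve-∀ to ℕ-solve-∀)
  open import Data.Product using (_,_; proj₁; ∃-syntax)
  open IntegerFacts
  open IntegerSums
  open TwoStepEnergy
  open ResidueCounts
  open NatFacts using (^-distribʳ-*; *-^-≤-suc-^; 2qd≤N)
  open import Data.Nat.DivMod using (_/_; _%_; m≡m%n+[m/n]*n; m%n<n)
  open Discrepancy t rec

  energy : ℕ → ℕ → ℤ
  energy m N = ∑ (2 ^ m) (λ ℓ → sq (Δ 1ℤ m ℓ N))

  sq-Δ≤energy : ∀ m k N → sq (Δ 1ℤ m k N) ≤ energy m N
  sq-Δ≤energy m k N = term≤∑-periodic (2 ^ m) {{ℕP.m^n≢0 2 m}} (λ ℓ → cong sq (Δ-periodic 1ℤ m N ℓ)) (λ ℓ → sq-nonNeg (Δ 1ℤ m ℓ N)) k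

  energy-nine≤ : ∀ m M → energy m (9 ℕ.* M) ≤ + 20 * energy (2 ℕ.+ m) (4 ℕ.* M)
  energy-nine≤ m M = begin
    energy m (9 ℕ.* M)                                  ≡⟨ ∑-cong (2 ^ m) (λ ℓ → cong sq (Δ-nine m ℓ M)) ⟩
    ∑ (2 ^ m) (λ ℓ → sq (tri 1ℤ (tri (+ 3) B) ℓ))        ≤⟨ Mod4.∑-sq-tri-tri≤ B (2 ^ m) B-per ⟩
    + 20 * ∑ (4 ℕ.* 2 ^ m) (λ x → sq (B x))             ≡⟨ cong (λ n → + 20 * ∑ n (λ x → sq (B x))) 4*2^m≡2^[2+m] ⟩
    + 20 * ∑ (2 ^ (2 ℕ.+ m)) (λ x → sq (B x))           ≡⟨ cong (+ 20 *_) (∑-odd-dilation (2 ℕ.+ m) (+ 4) sq∘B-per) ⟨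
    + 20 * ∑ (2 ^ (2 ℕ.+ m)) (λ x → sq (B (+ 9 * x)))   ≡⟨ cong (+ 20 *_) (∑-cong (2 ^ (2 ℕ.+ m)) (λ x → cong sq (Δ-odd-* (+ 4) (2 ℕ.+ m) x (4 ℕ.* M)))) ⟩
    + 20 * energy (2 ℕ.+ m) (4 ℕ.* M)                   ∎
    where
    open ℤP.≤-Reasoning
    B : ℤ → ℤ
    B x = Δ (+ 9) (2 ℕ.+ m) x (4 ℕ.* M)
    4*2^m≡2^[2+m] : 4 ℕ.* 2 ^ m ≡ 2 ^ (2 ℕ.+ m)
    4*2^m≡2^[2+m] = ℕP.*-assoc 2 2 (2 ^ m)
    B-per : Periodic (4 ℕ.* 2 ^ m) B
    B-per x = trans (cong (λ n → B (x + + n)) 4*2^m≡2^[2+m]) (Δ-periodic (+ 9) (2 ℕ.+ m) (4 ℕ.* M) x)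
    sq∘B-per : Periodic (2 ^ (2 ℕ.+ m)) (λ x → sq (B x))
    sq∘B-per x = cong sq (Δ-periodic (+ 9) (2 ℕ.+ m) (4 ℕ.* M) x)

  energy-base : ∀ m N → + (2 ^ m) * energy m N ≤ (+ N + + (2 ^ m)) * + N
  energy-base m N = begin
    + P * energy m N                                  ≡⟨ ∑-*ˡ P (+ P) (λ ℓ → sq (Δ 1ℤ m ℓ N)) ⟨
    ∑ P (λ ℓ → + P * sq (Δ 1ℤ m ℓ N))                 ≤⟨ ∑-mono-≤ P termwise ⟩
    ∑ P (λ ℓ → (+ N + + P) * count≡ m ℓ N)            ≡⟨ ∑-*ˡ P (+ N + + P) (λ ℓ → count≡ m ℓ N) ⟩
    (+ N + + P) * ∑ P (λ ℓ → count≡ m ℓ N)            ≡⟨ cong ((+ N + + P) *_) (∑-count≡ m N) ⟩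
    (+ N + + P) * + N                                 ∎
    where
    open ℤP.≤-Reasoning
    P = 2 ^ m
    termwise : ∀ ℓ → + P * sq (Δ 1ℤ m ℓ N) ≤ (+ N + + P) * count≡ m ℓ N
    termwise ℓ = begin
      + P * sq (Δ 1ℤ m ℓ N)     ≤⟨ ℤP.*-monoˡ-≤-nonNeg (+ P) (sq≤ {Δ 1ℤ m ℓ N} (∣Δ∣≤count≡ m ℓ N)) ⟩
      + P * (c * c)             ≡⟨ ℤP.*-assoc (+ P) c c ⟨
      + P * c * c               ≤⟨ ℤP.*-monoʳ-≤-nonNeg c {{nonNegative (count≡-nonNeg m ℓ N)}} (proj₁ (count≡-close m ℓ N)) ⟩
      (+ N + + P) * c           ∎
      where c = count≡ m ℓ N

  energy-iterate : ∀ L n M → energy n (9 ^ L ℕ.* M) ≤ + (20 ^ L) * energy (2 ℕ.* L ℕ.+ n) (4 ^ L ℕ.* M)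
  energy-iterate zero    n M = ℤP.≤-reflexive (sym (ℤP.*-identityˡ _))
  energy-iterate (suc L) n M = begin
    energy n (9 ^ suc L ℕ.* M)                                   ≡⟨ cong (energy n) (shuffle (9 ^ L) 9 M) ⟩
    energy n (9 ^ L ℕ.* (9 ℕ.* M))                               ≤⟨ energy-iterate L n (9 ℕ.* M) ⟩
    + (20 ^ L) * energy k (4 ^ L ℕ.* (9 ℕ.* M))                  ≡⟨ cong (λ N → + (20 ^ L) * energy k N) (swap (4 ^ L) 9 M) ⟩
    + (20 ^ L) * energy k (9 ℕ.* (4 ^ L ℕ.* M))                  ≤⟨ ℤP.*-monoˡ-≤-nonNeg (+ (20 ^ L)) (energy-nine≤ k (4 ^ L ℕ.* M)) ⟩
    + (20 ^ L) * (+ 20 * energy (2 ℕ.+ k) (4 ℕ.* (4 ^ L ℕ.* M)))  ≡⟨ ℤP.*-assoc (+ (20 ^ L)) (+ 20) _ ⟨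
    + (20 ^ L) * + 20 * energy (2 ℕ.+ k) (4 ℕ.* (4 ^ L ℕ.* M))    ≡⟨ cong₂ _*_ 20^L*20 (cong₂ energy (2+[2L+n] L n) (sym (ℕP.*-assoc 4 (4 ^ L) M))) ⟩
    + (20 ^ suc L) * energy (2 ℕ.* suc L ℕ.+ n) (4 ^ suc L ℕ.* M) ∎
    where
    open ℤP.≤-Reasoning
    k = 2 ℕ.* L ℕ.+ n
    shuffle : ∀ a b c → b ℕ.* a ℕ.* c ≡ a ℕ.* (b ℕ.* c)
    shuffle = ℕ-solve-∀
    swap : ∀ a b c → a ℕ.* (b ℕ.* c) ≡ b ℕ.* (a ℕ.* c)
    swap = ℕ-solve-∀
    2+[2L+n] : ∀ L n → 2 ℕ.+ (2 ℕ.* L ℕ.+ n) ≡ 2 ℕ.* suc L ℕ.+ n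
    2+[2L+n] = ℕ-solve-∀
    20^L*20 : + (20 ^ L) * + 20 ≡ + (20 ^ suc L)
    20^L*20 = trans (sym (ℤP.pos-* (20 ^ L) 20)) (cong +_ (ℕP.*-comm (20 ^ L) 20))

  2^[2L+n]·sq-Δ≤ : ∀ L n k M → let Q = 2 ^ (2 ℕ.* L ℕ.+ n); N = 4 ^ L ℕ.* M in
    + Q * sq (Δ 1ℤ n k (9 ^ L ℕ.* M)) ≤ + (20 ^ L) * ((+ N + + Q) * + N)
  2^[2L+n]·sq-Δ≤ L n k M = begin
    + Q * sq (Δ 1ℤ n k (9 ^ L ℕ.* M))    ≤⟨ ℤP.*-monoˡ-≤-nonNeg (+ Q) (sq-Δ≤energy n k (9 ^ L ℕ.* M)) ⟩
    + Q * energy n (9 ^ L ℕ.* M)         ≤⟨ ℤP.*-monoˡ-≤-nonNeg (+ Q) (energy-iterate L n M) ⟩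
    + Q * (+ Y * energy (2 ℕ.* L ℕ.+ n) N) ≡⟨ commute (+ Q) (+ Y) _ ⟩
    + Y * (+ Q * energy (2 ℕ.* L ℕ.+ n) N) ≤⟨ ℤP.*-monoˡ-≤-nonNeg (+ Y) (energy-base (2 ℕ.* L ℕ.+ n) N) ⟩
    + Y * ((+ N + + Q) * + N)            ∎
    where
    open ℤP.≤-Reasoning
    Q = 2 ^ (2 ℕ.* L ℕ.+ n)
    N = 4 ^ L ℕ.* M
    Y = 20 ^ L
    commute : ∀ a b c → a * (b * c) ≡ b * (a * c)
    commute = solve-∀

  ∣Δ∣²≤ : ∀ L n k M → let d = ∣ Δ 1ℤ n k (9 ^ L ℕ.* M) ∣ in
          2 ^ n ℕ.* (d ℕ.* d) ℕ.≤ 80 ^ L ℕ.* ((M ℕ.+ 2 ^ n) ℕ.* M)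
  ∣Δ∣²≤ L n k M = ℕP.*-cancelˡ-≤ X {{ℕP.m^n≢0 4 L}} (begin
    X ℕ.* (P ℕ.* (d ℕ.* d))                      ≡⟨ ℕP.*-assoc X P (d ℕ.* d) ⟨
    X ℕ.* P ℕ.* (d ℕ.* d)                        ≡⟨ cong (ℕ._* (d ℕ.* d)) Q≡X*P ⟨
    Q ℕ.* (d ℕ.* d)                              ≤⟨ ℤP.drop‿+≤+ (subst₂ _≤_ lhs≡ rhs≡ (2^[2L+n]·sq-Δ≤ L n k M)) ⟩
    Y ℕ.* ((X ℕ.* M ℕ.+ Q) ℕ.* (X ℕ.* M))        ≡⟨ cong (λ z → Y ℕ.* ((X ℕ.* M ℕ.+ z) ℕ.* (X ℕ.* M))) Q≡X*P ⟩
    Y ℕ.* ((X ℕ.* M ℕ.+ X ℕ.* P) ℕ.* (X ℕ.* M))  ≡⟨ factor Y X M P ⟩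
    X ℕ.* (Y ℕ.* X ℕ.* ((M ℕ.+ P) ℕ.* M))        ≡⟨ cong (λ z → X ℕ.* (z ℕ.* ((M ℕ.+ P) ℕ.* M))) (^-distribʳ-* 20 4 L) ⟨
    X ℕ.* (80 ^ L ℕ.* ((M ℕ.+ P) ℕ.* M))         ∎)
    where
    open ℕP.≤-Reasoning
    X = 4 ^ L
    Y = 20 ^ L
    P = 2 ^ n
    Q = 2 ^ (2 ℕ.* L ℕ.+ n)
    D = Δ 1ℤ n k (9 ^ L ℕ.* M)
    d = ∣ D ∣
    Q≡X*P : Q ≡ X ℕ.* P
    Q≡X*P = trans (ℕP.^-distribˡ-+-* 2 (2 ℕ.* L) n) (cong (ℕ._* P) (sym (ℕP.^-*-assoc 2 2 L)))
    factor : ∀ Y X M P → Y ℕ.* ((X ℕ.* M ℕ.+ X ℕ.* P) ℕ.* (X ℕ.* M)) ≡ X ℕ.* (Y ℕ.* X ℕ.* ((M ℕ.+ P) ℕ.* M))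
    factor = ℕ-solve-∀
    lhs≡ : + Q * sq D ≡ + (Q ℕ.* (d ℕ.* d))
    lhs≡ = trans (cong (+ Q *_) (sq≡∣∣*∣∣ D)) (sym (ℤP.pos-* Q (d ℕ.* d)))
    rhs≡ : + Y * ((+ (X ℕ.* M) + + Q) * + (X ℕ.* M)) ≡ + (Y ℕ.* ((X ℕ.* M ℕ.+ Q) ℕ.* (X ℕ.* M)))
    rhs≡ = trans (cong (λ z → + Y * (z * + (X ℕ.* M))) (sym (ℤP.pos-+ (X ℕ.* M) Q)))
          (trans (cong (+ Y *_) (sym (ℤP.pos-* (X ℕ.* M ℕ.+ Q) (X ℕ.* M)))) (sym (ℤP.pos-* Y _)))

  Δ-sublinear : ∀ n k q → ∃[ N₀ ] ∀ N → N₀ ℕ.≤ N → q ℕ.* ∣ Δ 1ℤ n k N ∣ ℕ.≤ N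
  Δ-sublinear n k q = 8 ℕ.* (q ℕ.* q) ℕ.* B ℕ.* P ℕ.+ 2 ℕ.* q ℕ.* A , bound
    where
    -- Large enough that 8q²·80^L ≤ 81^L = A·A, by Bernoulli's inequality.
    L = 80 ℕ.* (8 ℕ.* (q ℕ.* q))
    A = 9 ^ L
    B = 80 ^ L
    P = 2 ^ n
    instance
      A≢0 : ℕ.NonZero A
      A≢0 = ℕP.m^n≢0 9 L
      P≢0 : ℕ.NonZero P
      P≢0 = ℕP.m^n≢0 2 n
    8q²B≤A² : 8 ℕ.* (q ℕ.* q) ℕ.* B ℕ.≤ A ℕ.* A
    8q²B≤A² = subst (8 ℕ.* (q ℕ.* q) ℕ.* B ℕ.≤_) (^-distribʳ-* 9 9 L) (*-^-≤-suc-^ 80 (8 ℕ.* (q ℕ.* q)))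
    bound : ∀ N → 8 ℕ.* (q ℕ.* q) ℕ.* B ℕ.* P ℕ.+ 2 ℕ.* q ℕ.* A ℕ.≤ N → q ℕ.* ∣ Δ 1ℤ n k N ∣ ℕ.≤ N
    bound N N₀≤N = ℕP.*-cancelˡ-≤ 2 (begin
      2 ℕ.* (q ℕ.* ∣ Δ 1ℤ n k N ∣)           ≡⟨ cong (λ N → 2 ℕ.* (q ℕ.* ∣ Δ 1ℤ n k N ∣)) N≡AM+r ⟩
      2 ℕ.* (q ℕ.* ∣ Δ 1ℤ n k (A ℕ.* M ℕ.+ r) ∣) ≤⟨ ℕP.*-monoʳ-≤ 2 (ℕP.*-monoʳ-≤ q (∣Δ-++∣≤ 1ℤ n k (A ℕ.* M) r)) ⟩
      2 ℕ.* (q ℕ.* (d ℕ.+ r))                 ≡⟨ distribute q d r ⟩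
      2 ℕ.* q ℕ.* d ℕ.+ 2 ℕ.* q ℕ.* r         ≤⟨ ℕP.+-mono-≤ 2qd≤N′ 2qr≤N ⟩
      N ℕ.+ N                                 ≡⟨ cong (N ℕ.+_) (ℕP.+-identityʳ N) ⟨
      2 ℕ.* N                                 ∎)
      where
      open ℕP.≤-Reasoning
      M = N / A
      r = N % A
      N≡AM+r : N ≡ A ℕ.* M ℕ.+ r
      N≡AM+r = trans (m≡m%n+[m/n]*n N A) (trans (ℕP.+-comm r (M ℕ.* A)) (cong (ℕ._+ r) (ℕP.*-comm M A)))
      d = ∣ Δ 1ℤ n k (A ℕ.* M) ∣
      AM≤N : A ℕ.* M ℕ.≤ N
      AM≤N = subst (A ℕ.* M ℕ.≤_) (sym N≡AM+r) (ℕP.m≤m+n (A ℕ.* M) r)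
      2qd≤N′ : 2 ℕ.* q ℕ.* d ℕ.≤ N
      2qd≤N′ = 2qd≤N {P} {B} {A} {q} {d} {M} {N} (∣Δ∣²≤ L n k M) 8q²B≤A² AM≤N (ℕP.≤-trans (ℕP.m≤n*m M A) AM≤N)
                     (ℕP.≤-trans (ℕP.m≤m+n _ _) N₀≤N)
      2qr≤N : 2 ℕ.* q ℕ.* r ℕ.≤ N
      2qr≤N = ℕP.≤-trans (ℕP.*-monoʳ-≤ (2 ℕ.* q) (ℕP.<⇒≤ (m%n<n N A))) (ℕP.≤-trans (ℕP.m≤n+m _ _) N₀≤N)
      distribute : ∀ q d r → 2 ℕ.* (q ℕ.* (d ℕ.+ r)) ≡ 2 ℕ.* q ℕ.* d ℕ.+ 2 ℕ.* q ℕ.* r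
      distribute = ℕ-solve-∀

module Frequencies (t : ℕ → Bool) (rec : Recurrence32 t) where

  open import Data.Nat as ℕ using (ℕ; zero; suc; _^_)
  open import Data.Bool using (Bool; true; false)
  open import Defs using (C; Count)
  import Data.Nat.Properties as ℕP
  import Data.Nat.Divisibility as ℕD
  open import Data.Bool.Properties using () renaming (_≟_ to _≟ᵇ_)
  open import Data.Integer using (ℤ; +_; _+_; _*_; _-_; -_; 0ℤ; 1ℤ; ∣_∣)
  import Data.Integer.Properties as ℤP
  open import Data.Integer.Tactic.RingSolver using (solve-∀)
  open import Data.Nat.Tactic.RingSolver using () renaming (solve-∀ to ℕ-solve-∀)
  open import Data.Product using (_,_; proj₁; proj₂; ∃-syntax)
  open import Data.Empty using (⊥-elim)
  open import Relation.Nullary using (yes; no; ¬_)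
  open import Relation.Binary.PropositionalEquality
  open IntegerSums
  open PowerOfTwoIndicator
  open ResidueCounts
  open Discrepancy t rec
  open DiscrepancyEnergy t rec

  sgn² : ∀ b → sgn b * sgn b ≡ 1ℤ
  sgn² true  = refl
  sgn² false = refl

  sgn-≢ : ∀ {a b} → ¬ a ≡ b → sgn a ≡ - sgn b
  sgn-≢ {true}  {true}  a≢b = ⊥-elim (a≢b refl)
  sgn-≢ {false} {false} a≢b = ⊥-elim (a≢b refl)
  sgn-≢ {true}  {false} _   = refl
  sgn-≢ {false} {true}  _   = refl

  module _ (x a S s : ℤ) (IH : + 2 * x ≡ a + s * S) where

    step-counted : s * s ≡ 1ℤ → + 2 * (x + 1ℤ) ≡ (a + 1ℤ) + s * (S + 1ℤ * s)
    step-counted s²≡1 = begin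
      + 2 * (x + 1ℤ)               ≡⟨ expand x ⟩
      + 2 * x + 1ℤ + 1ℤ            ≡⟨ cong (λ z → z + 1ℤ + 1ℤ) IH ⟩
      a + s * S + 1ℤ + 1ℤ          ≡⟨ cong (λ z → a + s * S + 1ℤ + z) s²≡1 ⟨
      a + s * S + 1ℤ + s * s       ≡⟨ regroup a s S ⟩
      (a + 1ℤ) + s * (S + 1ℤ * s)  ∎
      where open ≡-Reasoning
            expand : ∀ x → + 2 * (x + 1ℤ) ≡ + 2 * x + 1ℤ + 1ℤ
            expand = solve-∀
            regroup : ∀ a s S → a + s * S + 1ℤ + s * s ≡ (a + 1ℤ) + s * (S + 1ℤ * s)
            regroup = solve-∀

    step-other-letter : s * s ≡ 1ℤ → + 2 * x ≡ (a + 1ℤ) + s * (S + 1ℤ * - s)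
    step-other-letter s²≡1 = begin
      + 2 * x                      ≡⟨ IH ⟩
      a + s * S                    ≡⟨ regroup a s S ⟩
      a + s * S + 1ℤ - 1ℤ          ≡⟨ cong (λ z → a + s * S + 1ℤ - z) s²≡1 ⟨
      a + s * S + 1ℤ - s * s       ≡⟨ regroup′ a s S ⟩
      (a + 1ℤ) + s * (S + 1ℤ * - s) ∎
      where open ≡-Reasoning
            regroup : ∀ a s S → a + s * S ≡ a + s * S + 1ℤ - 1ℤ
            regroup = solve-∀
            regroup′ : ∀ a s S → a + s * S + 1ℤ - s * s ≡ (a + 1ℤ) + s * (S + 1ℤ * - s)
            regroup′ = solve-∀

    step-other-residue : ∀ e → + 2 * x ≡ (a + 0ℤ) + s * (S + 0ℤ * e)
    step-other-residue e = trans IH (pad a s S e)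
      where pad : ∀ a s S e → a + s * S ≡ (a + 0ℤ) + s * (S + 0ℤ * e)
            pad = solve-∀

  private
    S : ℕ → ℤ → ℕ → ℤ
    S n k N = ∑ N (λ x → [2^ n ∣ x - k ] * σ ∣ x ∣)

  C-relation : ∀ n c k N → + 2 * + C t n c k N ≡ count≡ n k N + sgn c * ∑ N (λ x → [2^ n ∣ x - k ] * σ ∣ x ∣)
  C-relation n c k zero = sym (trans (ℤP.+-identityˡ _) (ℤP.*-zeroʳ (sgn c)))
  C-relation n c k (suc N) with t N ≟ᵇ c | 2 ^ n ℕD.∣? ∣ + N - k ∣
  ... | yes tN≡c | yes _ = trans (cong (λ m → + 2 * + m) (ℕP.+-comm 1 (C t n c k N)))
                                 (subst (λ σN → + 2 * (x + 1ℤ) ≡ (a + 1ℤ) + sgn c * (S n k N + 1ℤ * σN)) (cong sgn (sym tN≡c))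
                                        (step-counted x a (S n k N) (sgn c) (C-relation n c k N) (sgn² c)))
    where x = + C t n c k N ; a = count≡ n k N
  ... | no tN≢c  | yes _ = subst (λ σN → + 2 * x ≡ (a + 1ℤ) + sgn c * (S n k N + 1ℤ * σN)) (sym (sgn-≢ tN≢c))
                                 (step-other-letter x a (S n k N) (sgn c) (C-relation n c k N) (sgn² c))
    where x = + C t n c k N ; a = count≡ n k N
  ... | yes _    | no _  = step-other-residue (+ C t n c k N) (count≡ n k N) (S n k N) (sgn c) (C-relation n c k N) (σ N)
  ... | no _     | no _  = step-other-residue (+ C t n c k N) (count≡ n k N) (S n k N) (sgn c) (C-relation n c k N) (σ N)

  Count≡C₀ : ∀ c N → Count t c N ≡ C t 0 c 0ℤ N
  Count≡C₀ c zero = refl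
  Count≡C₀ c (suc N) with t N ≟ᵇ c | 2 ^ 0 ℕD.∣? ∣ + N - 0ℤ ∣
  ... | yes _ | yes _ = cong suc (Count≡C₀ c N)
  ... | yes _ | no 1∤ = ⊥-elim (1∤ (ℕD.1∣ _))
  ... | no _  | _     = Count≡C₀ c N

  C-deviation : ∀ n c k N → + (2 ^ suc n) * + C t n c k N - + N ≡
                (+ (2 ^ n) * count≡ n k N - + N) + + (2 ^ n) * (sgn c * Δ 1ℤ n k N)
  C-deviation n c k N = begin
    + (2 ^ suc n) * + C t n c k N - + N                 ≡⟨ cong (λ z → z * + C t n c k N - + N) (2^-suc n) ⟩
    + 2 * + P * + C t n c k N - + N                     ≡⟨ reassoc (+ P) (+ C t n c k N) (+ N) ⟩
    + P * (+ 2 * + C t n c k N) - + N                   ≡⟨ cong (λ z → + P * z - + N) (C-relation n c k N) ⟩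
    + P * (c′ + sgn c * ∑ N (λ x → [2^ n ∣ x - k ] * σ ∣ x ∣)) - + N
                                                        ≡⟨ cong (λ z → + P * (c′ + sgn c * z) - + N) (Δ₁-≡ n k N) ⟨
    + P * (c′ + sgn c * Δ 1ℤ n k N) - + N               ≡⟨ distribute (+ P) c′ (sgn c * Δ 1ℤ n k N) (+ N) ⟩
    (+ P * c′ - + N) + + P * (sgn c * Δ 1ℤ n k N)       ∎
    where
    open ≡-Reasoning
    P = 2 ^ n
    c′ = count≡ n k N
    reassoc : ∀ P C N → + 2 * P * C - N ≡ P * (+ 2 * C) - N
    reassoc = solve-∀
    distribute : ∀ P c x N → P * (c + x) - N ≡ (P * c - N) + P * x
    distribute = solve-∀

  C-close : ∀ n c k N → ∣ + (2 ^ suc n) * + C t n c k N - + N ∣ ℕ.≤ 2 ^ n ℕ.* suc ∣ Δ 1ℤ n k N ∣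
  C-close n c k N = begin
    ∣ + (2 ^ suc n) * + C t n c k N - + N ∣           ≡⟨ cong ∣_∣ (C-deviation n c k N) ⟩
    ∣ (+ P * c′ - + N) + + P * (sgn c * D) ∣          ≤⟨ ℤP.∣i+j∣≤∣i∣+∣j∣ (+ P * c′ - + N) _ ⟩
    ∣ + P * c′ - + N ∣ ℕ.+ ∣ + P * (sgn c * D) ∣      ≤⟨ ℕP.+-monoˡ-≤ _ (proj₂ (count≡-close n k N)) ⟩
    P ℕ.+ ∣ + P * (sgn c * D) ∣                       ≡⟨ cong (P ℕ.+_) ∣P*sD∣ ⟩
    P ℕ.+ P ℕ.* ∣ D ∣                                 ≡⟨ ℕP.*-suc P ∣ D ∣ ⟨
    P ℕ.* suc ∣ D ∣                                   ∎
    where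
    open ℕP.≤-Reasoning
    P = 2 ^ n
    c′ = count≡ n k N
    D = Δ 1ℤ n k N
    ∣P*sD∣ : ∣ + P * (sgn c * D) ∣ ≡ P ℕ.* ∣ D ∣
    ∣P*sD∣ = begin-equality
      ∣ + P * (sgn c * D) ∣             ≡⟨ ℤP.∣i*j∣≡∣i∣*∣j∣ (+ P) (sgn c * D) ⟩
      P ℕ.* ∣ sgn c * D ∣               ≡⟨ cong (P ℕ.*_) (ℤP.∣i*j∣≡∣i∣*∣j∣ (sgn c) D) ⟩
      P ℕ.* (∣ sgn c ∣ ℕ.* ∣ D ∣)       ≡⟨ cong (λ z → P ℕ.* (z ℕ.* ∣ D ∣)) (∣sgn∣≡1 c) ⟩
      P ℕ.* (1 ℕ.* ∣ D ∣)               ≡⟨ cong (P ℕ.*_) (ℕP.*-identityˡ ∣ D ∣) ⟩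
      P ℕ.* ∣ D ∣                       ∎

  C-frequency : ∀ n c k q → ∃[ N₀ ] ∀ N → N₀ ℕ.≤ N →
                q ℕ.* ∣ + (2 ^ suc n) * + C t n c k N - + N ∣ ℕ.≤ 2 ^ n ℕ.* N
  C-frequency n c k q = N₁ ℕ.+ 2 ℕ.* q , bound
    where
    N₁ = proj₁ (Δ-sublinear n k (2 ℕ.* q))
    2q∣Δ∣≤N = proj₂ (Δ-sublinear n k (2 ℕ.* q))
    bound : ∀ N → N₁ ℕ.+ 2 ℕ.* q ℕ.≤ N → q ℕ.* ∣ + (2 ^ suc n) * + C t n c k N - + N ∣ ℕ.≤ 2 ^ n ℕ.* N
    bound N N₀≤N = begin
      q ℕ.* ∣ + (2 ^ suc n) * + C t n c k N - + N ∣  ≤⟨ ℕP.*-monoʳ-≤ q (C-close n c k N) ⟩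
      q ℕ.* (P ℕ.* suc d)                           ≡⟨ ℕP.*-assoc q P (suc d) ⟨
      q ℕ.* P ℕ.* suc d                             ≡⟨ cong (ℕ._* suc d) (ℕP.*-comm q P) ⟩
      P ℕ.* q ℕ.* suc d                             ≡⟨ ℕP.*-assoc P q (suc d) ⟩
      P ℕ.* (q ℕ.* suc d)                           ≤⟨ ℕP.*-monoʳ-≤ P q[1+d]≤N ⟩
      P ℕ.* N                                       ∎
      where
      open ℕP.≤-Reasoning
      P = 2 ^ n
      d = ∣ Δ 1ℤ n k N ∣
      q[1+d]≤N : q ℕ.* suc d ℕ.≤ N
      q[1+d]≤N = ℕP.*-cancelˡ-≤ 2 (begin
        2 ℕ.* (q ℕ.* suc d)                ≡⟨ distribute q d ⟩
        2 ℕ.* q ℕ.+ 2 ℕ.* q ℕ.* d          ≤⟨ ℕP.+-mono-≤ (ℕP.≤-trans (ℕP.m≤n+m _ N₁) N₀≤N)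
                                                          (2q∣Δ∣≤N N (ℕP.≤-trans (ℕP.m≤m+n N₁ _) N₀≤N)) ⟩
        N ℕ.+ N                            ≡⟨ cong (N ℕ.+_) (ℕP.+-identityʳ N) ⟨
        2 ℕ.* N                            ∎)
        where distribute : ∀ q d → 2 ℕ.* (q ℕ.* suc d) ≡ 2 ℕ.* q ℕ.+ 2 ℕ.* q ℕ.* d
              distribute = ℕ-solve-∀

open import Defs
open import Data.Bool using (Bool)
open import Data.Nat using (ℕ; suc; _≤_; _^_)
open import Data.Nat.Properties using (m^n≢0; m≤n⇒m≤1+n)
open import Data.Integer using (ℤ; +_)
open import Data.Rational using (ℚ; 0ℚ; _/_; _-_; ∣_∣; _<_; ↧ₙ_)
open import Data.Product using (_×_; ∃-syntax; _,_; proj₁; proj₂)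
open import Relation.Binary.PropositionalEquality using (subst; sym)
open RationalBound using (∣x/N-1/2P∣<ε)

theorem18 : (t : ℕ → Bool) → IsThueMorse32 t →
    ((n : ℕ) (c : Bool) (k : ℤ) (ε : ℚ) → 0ℚ < ε →
      ∃[ M₀ ] ∀ M → M₀ ≤ M →
        ∣ (+ C t n c k (suc M)) / suc M - _/_ (+ 1) (2 ^ suc n) ⦃ m^n≢0 2 (suc n) ⦄ ∣ < ε)
    × ((c : Bool) (ε : ℚ) → 0ℚ < ε →
      ∃[ M₀ ] ∀ M → M₀ ≤ M →
        ∣ (+ Count t c (suc M)) / suc M - (+ 1) / 2 ∣ < ε)
-- Only the recurrences are used: the value of t 0 plays no role.
theorem18 t (_ , rec) = C-limit , Count-limit
  where
  open Frequencies t rec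
  C-limit : (n : ℕ) (c : Bool) (k : ℤ) (ε : ℚ) → 0ℚ < ε →
            ∃[ M₀ ] ∀ M → M₀ ≤ M → ∣ (+ C t n c k (suc M)) / suc M - _/_ (+ 1) (2 ^ suc n) ⦃ m^n≢0 2 (suc n) ⦄ ∣ < ε
  C-limit n c k ε 0<ε = proj₁ frequency , λ M N₀≤M →
    ∣x/N-1/2P∣<ε (C t n c k (suc M)) M (2 ^ n) {{m^n≢0 2 n}} ε 0<ε (proj₂ frequency (suc M) (m≤n⇒m≤1+n N₀≤M))
    where frequency = C-frequency n c k (↧ₙ ε)
  Count-limit : (c : Bool) (ε : ℚ) → 0ℚ < ε → ∃[ M₀ ] ∀ M → M₀ ≤ M → ∣ (+ Count t c (suc M)) / suc M - (+ 1) / 2 ∣ < ε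
  Count-limit c ε 0<ε = proj₁ limit , λ M M₀≤M →
    subst (λ x → ∣ (+ x) / suc M - (+ 1) / 2 ∣ < ε) (sym (Count≡C₀ c (suc M))) (proj₂ limit M M₀≤M)
    where limit = C-limit 0 c (+ 0) ε 0<ε
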